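{- Let $A$ be an expression, $N$ a term and $\mathbb N$ a finite sum of terms of the $\partial\lambda$-calculus with tests, and let $x$ be a variable not free in $N$ nor in $\mathbb N$. Then (i) $\mathcal T(A\langle N/x\rangle)=\mathcal T(A)\langle\mathcal T(N)/x\rangle$; (ii) $\mathcal T(A\{\mathbb N/x\})=\bigcup_{P}\mathcal T(A)\langle P/x\rangle\{0/x\}$, the union ranging over all finite multisets $P$ of elements of $\mathcal T(\mathbb N)$.
   Context: Syntax of the $\partial\lambda$-calculus with tests. Terms $M,N,L$, bags $P$, tests $V$: $M::=x\mid\lambda x.M\mid MP\mid\bar\tau(V)$, $P::=[L_1,\dots,L_k,\mathbb N^{!}]$, $V::=\tau[L_1,\dots,L_k]$ ($k\ge0$), $\mathbb N$ a finite sum of terms; up to $\alpha$-equivalence. Sums are finite formal sums with idempotent addition (identified with finite sets), $0$ the empty sum. $[L_1,\dots,L_k]$ stands for $[L_1,\dots,L_k,0^!]$; bag union $[\vec L,\mathbb N^!]\uplus[\vec L',\mathbb M^!]=[\vec L,\vec L',(\mathbb N+\mathbb M)^!]$. Constructors are extended to sums multilinearly (constructors applied to $0$ give $0$), except that the promoted component is not distributed. $A\{\mathbb N/x\}$ replaces each free occurrence of $x$ by $\mathbb N$; $A\{0/x\}$ is $0$ if $x$ occurs free in $A$ outside promoted components, in general computed by these conventions. Linear substitution: $x\langle N/x\rangle=N$, $y\langle N/x\rangle=0$ ($y\ne x$), $(\lambda y.M)\langle N/x\rangle=\lambda y.M\langle N/x\rangle$, $(MP)\langle N/x\rangle=M\langle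 N/x\rangle P+M(P\langle N/x\rangle)$, $\bar\tau(V)\langle N/x\rangle=\bar\tau(V\langle N/x\rangle)$, $\tau[L_1,\dots,L_k]\langle N/x\rangle=\sum_i\tau[L_1,\dots,L_i\langle N/x\rangle,\dots,L_k]$, $[L_1,\dots,L_k,\mathbb N^!]\langle N/x\rangle=\sum_i[L_1,\dots,L_i\langle N/x\rangle,\dots,L_k,\mathbb N^!]+[L_1,\dots,L_k,\mathbb N\langle N/x\rangle,\mathbb N^!]$, bilinear on sums. For a bag $P=[L_1,\dots,L_k]$ with $x$ not free in $P$, $A\langle P/x\rangle:=A\langle L_1/x\rangle\cdots\langle L_k/x\rangle$. These operations are extended to (possibly infinite) sets of expressions elementwise: for sets $X,Y$, $X\langle Y/x\rangle=\bigcup_{A'\in X,N'\in Y}A'\langle N'/x\rangle$, $X\langle P/x\rangle\{0/x\}=\bigcup_{A'\in X}A'\langle P/x\rangle\{0/x\}$ (sums being identified with sets). Taylor expansion: $\mathcal T(x)=\{x\}$; $\mathcal T(\lambda x.M)=\{\lambda x.M':M'\in\mathcal T(M)\}$; $\mathcal T(MP)=\{M'P':M'\in\mathcal T(M),P'\in\mathcal T(P)\}$; $\mathcal T(\bar\tau(V))=\{\bar\tau(V'):V'\in\mathcal T(V)\}$; $\mathcal T(\tau[M_1,\dots,M_k])=\{\tau[M'_1,\dots,M'_k]:M'_i\in\mathcal T(M_i)\}$; $\mathcal T([L_1,\dots,L_k,\mathbb N^!])=\{[L'_1,\dots,L'_k]\uplus P:L'_i\in\mathcal T(L_i),\ P\text{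 a finite multiset of elements of }\mathcal T(\mathbb N)\}$; $\mathcal T(\sum_iA_i)=\bigcup_i\mathcal T(A_i)$. Its values are sets of promotion-free expressions (all bags of the form $[L_1,\dots,L_k]$). -}

module Defs where

-- ∂λ-calculus with tests, in de Bruijn notation (so terms are taken up to α).
-- Sums are finite formal sums with idempotent addition, represented as lists
-- read as finite sets (membership).  Bags are multisets, represented as lists
-- taken up to permutation (the relation _≈_ below).

open import Data.Nat using (ℕ; zero; suc; _<ᵇ_; _≡ᵇ_)
open import Data.Bool using (if_then_else_)
open import Data.List using (List; []; _∷_; _++_; map; concatMap)
open import Data.List.Relation.Unary.All using (All)
open import Data.List.Relation.Unary.Any using (Any)
open import Data.List.Relation.Binary.Pointwise using (Pointwise)
open import Data.List.Membership.Propositional using (_∈_)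
open import Data.Product using (Σ; _×_; ∃; ∃-syntax)
open import Data.Sum using (_⊎_)
open import Relation.Binary.PropositionalEquality using (_≡_)

data Sort : Set where
  tm bg ts : Sort

-- Exp tm : terms  M ::= x | λx.M | M P | τ̄(V)
-- Exp bg : bags   P ::= [L₁,…,Lₖ, 𝕄^!]   (bag Ls S : Ls linear part, S the promoted sum)
-- Exp ts : tests  V ::= τ[L₁,…,Lₖ]
data Exp : Sort → Set where
  var  : ℕ → Exp tm
  lam  : Exp tm → Exp tm
  app  : Exp tm → Exp bg → Exp tm
  tbar : Exp ts → Exp tm
  bag  : List (Exp tm) → List (Exp tm) → Exp bg
  tau  : List (Exp tm) → Exp ts

Sum : Sort → Set
Sum s = List (Exp s)

-- [L₁,…,Lₖ] = [L₁,…,Lₖ,0^!]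
bag₀ : List (Exp tm) → Exp bg
bag₀ Ls = bag Ls []

mutual
  data Free (x : ℕ) : {s : Sort} → Exp s → Set where
    fvar  : Free x (var x)
    flam  : ∀ {M} → Free (suc x) M → Free x (lam M)
    fappl : ∀ {M P} → Free x M → Free x (app M P)
    fappr : ∀ {M P} → Free x P → Free x (app M P)
    ftbar : ∀ {V} → Free x V → Free x (tbar V)
    ftau  : ∀ {Ls} → FreeL x Ls → Free x (tau Ls)
    fbagl : ∀ {Ls S} → FreeL x Ls → Free x (bag Ls S)
    fbagp : ∀ {Ls S} → FreeL x S → Free x (bag Ls S)

  data FreeL (x : ℕ) : List (Exp tm) → Set where
    here  : ∀ {L Ls} → Free x L → FreeL x (L ∷ Ls)
    there : ∀ {L Ls} → FreeL x Ls → FreeL x (L ∷ Ls)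

mutual
  shift : {s : Sort} → ℕ → Exp s → Exp s
  shift c (var y)    = if y <ᵇ c then var y else var (suc y)
  shift c (lam M)    = lam (shift (suc c) M)
  shift c (app M P)  = app (shift c M) (shift c P)
  shift c (tbar V)   = tbar (shift c V)
  shift c (bag Ls S) = bag (shiftL c Ls) (shiftL c S)
  shift c (tau Ls)   = tau (shiftL c Ls)

  shiftL : ℕ → List (Exp tm) → List (Exp tm)
  shiftL c []       = []
  shiftL c (L ∷ Ls) = shift c L ∷ shiftL c Ls

mutual
  lsub : {s : Sort} → ℕ → Exp tm → Exp s → Sum s
  lsub x N (var y)    = if y ≡ᵇ x then N ∷ [] else []
  lsub x N (lam M)    = map lam (lsub (suc x) (shift 0 N) M)
  lsub x N (app M P)  = map (λ M' → app M' P) (lsub x N M) ++ map (app M) (lsub x N P)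
  lsub x N (tbar V)   = map tbar (lsub x N V)
  lsub x N (tau Ls)   = map tau (lsubL x N Ls)
  lsub x N (bag Ls S) = map (λ Ls' → bag Ls' S) (lsubL x N Ls)
                        ++ map (λ M' → bag (Ls ++ (M' ∷ [])) S) (lsubS x N S)

  lsubL : ℕ → Exp tm → List (Exp tm) → List (List (Exp tm))
  lsubL x N []       = []
  lsubL x N (L ∷ Ls) = map (_∷ Ls) (lsub x N L) ++ map (L ∷_) (lsubL x N Ls)

  lsubS : ℕ → Exp tm → List (Exp tm) → List (Exp tm)
  lsubS x N []      = []
  lsubS x N (M ∷ S) = lsub x N M ++ lsubS x N S

lsubMany : {s : Sort} → ℕ → List (Exp tm) → Exp s → Sum s
lsubMany x []       A = A ∷ []
lsubMany x (L ∷ Ls) A = concatMap (lsubMany x Ls) (lsub x L A)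

-- (full) substitution  A{𝕄/x}  (result is a sum; promoted parts not distributed)

mutual
  sub : {s : Sort} → ℕ → Sum tm → Exp s → Sum s
  sub x 𝕄 (var y)    = if y ≡ᵇ x then 𝕄 else var y ∷ []
  sub x 𝕄 (lam M)    = map lam (sub (suc x) (map (shift 0) 𝕄) M)
  sub x 𝕄 (app M P)  = concatMap (λ M' → map (app M') (sub x 𝕄 P)) (sub x 𝕄 M)
  sub x 𝕄 (tbar V)   = map tbar (sub x 𝕄 V)
  sub x 𝕄 (tau Ls)   = map tau (subL x 𝕄 Ls)
  sub x 𝕄 (bag Ls S) = map (λ Ls' → bag Ls' (subS x 𝕄 S)) (subL x 𝕄 Ls)

  subL : ℕ → Sum tm → List (Exp tm) → List (List (Exp tm))
  subL x 𝕄 []       = [] ∷ []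
  subL x 𝕄 (L ∷ Ls) = concatMap (λ L' → map (L' ∷_) (subL x 𝕄 Ls)) (sub x 𝕄 L)

  subS : ℕ → Sum tm → List (Exp tm) → List (Exp tm)
  subS x 𝕄 []      = []
  subS x 𝕄 (M ∷ S) = sub x 𝕄 M ++ subS x 𝕄 S

-- Taylor expansion, as a membership relation:  Tay A B  means  B ∈ 𝒯(A)

mutual
  data Tay : {s : Sort} → Exp s → Exp s → Set where
    tvar  : ∀ {y} → Tay (var y) (var y)
    tlam  : ∀ {M M'} → Tay M M' → Tay (lam M) (lam M')
    tapp  : ∀ {M M' P P'} → Tay M M' → Tay P P' → Tay (app M P) (app M' P')
    ttbar : ∀ {V V'} → Tay V V' → Tay (tbar V) (tbar V')
    ttau  : ∀ {Ls Ls'} → TayL Ls Ls' → Tay (tau Ls) (tau Ls')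
    tbag  : ∀ {Ls Ls' S Ps} → TayL Ls Ls' → TaySums S Ps → Tay (bag Ls S) (bag₀ (Ls' ++ Ps))

  data TayL : List (Exp tm) → List (Exp tm) → Set where
    []  : TayL [] []
    _∷_ : ∀ {L L' Ls Ls'} → Tay L L' → TayL Ls Ls' → TayL (L ∷ Ls) (L' ∷ Ls')

  data TaySums (S : List (Exp tm)) : List (Exp tm) → Set where
    []  : TaySums S []
    _∷_ : ∀ {Q Qs} → TaySum S Q → TaySums S Qs → TaySums S (Q ∷ Qs)

  data TaySum {s : Sort} : Sum s → Exp s → Set where
    here  : ∀ {A As B} → Tay A B → TaySum (A ∷ As) B
    there : ∀ {A As B} → TaySum As B → TaySum (A ∷ As) B

-- Identification of expressions: bags (and test bags) are multisets, and
-- promoted sums are finite sets.  _≈_ is the congruence generated by this.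

mutual
  data _≈_ : {s : Sort} → Exp s → Exp s → Set where
    ≈var  : ∀ {y} → var y ≈ var y
    ≈lam  : ∀ {M M'} → M ≈ M' → lam M ≈ lam M'
    ≈app  : ∀ {M M' P P'} → M ≈ M' → P ≈ P' → app M P ≈ app M' P'
    ≈tbar : ∀ {V V'} → V ≈ V' → tbar V ≈ tbar V'
    ≈tau  : ∀ {Ls Ls'} → Ls ≋ Ls' → tau Ls ≈ tau Ls'
    ≈bag  : ∀ {Ls Ls' S S'} → Ls ≋ Ls' → S ≈ₛ S' → bag Ls S ≈ bag Ls' S'

  data _≋_ : List (Exp tm) → List (Exp tm) → Set where
    []    : [] ≋ []
    _∷_   : ∀ {L L' Ls Ls'} → L ≈ L' → Ls ≋ Ls' → (L ∷ Ls) ≋ (L' ∷ Ls')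
    swap  : ∀ {L L' Ls} → (L ∷ L' ∷ Ls) ≋ (L' ∷ L ∷ Ls)
    trans : ∀ {Ls Ls' Ls''} → Ls ≋ Ls' → Ls' ≋ Ls'' → Ls ≋ Ls''

  data _≈ₛ_ (S S' : List (Exp tm)) : Set where
    sumeq : (∀ {M} → M ∈ S → ∃[ M' ] (M' ∈ S' × M ≈ M'))
          → (∀ {M'} → M' ∈ S' → ∃[ M ] (M ∈ S × M ≈ M'))
          → S ≈ₛ S'

ESet : Sort → Set₁
ESet s = Exp s → Set

_≐_ : {s : Sort} → ESet s → ESet s → Set
X ≐ Y = (∀ B → X B → ∃[ C ] (Y C × B ≈ C))
      × (∀ C → Y C → ∃[ B ] (X B × B ≈ C))

𝒯 : {s : Sort} → Exp s → ESet s
𝒯 A = Tay A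

𝒯Σ : {s : Sort} → Sum s → ESet s
𝒯Σ S = TaySum S

_⟨_/_⟩ₛ : {s : Sort} → ESet s → ESet tm → ℕ → ESet s
(X ⟨ Y / x ⟩ₛ) B = ∃[ A' ] ∃[ N' ] (X A' × Y N' × B ∈ lsub x N' A')

_⟨_/_⟩⦃0⦄ₛ : {s : Sort} → ESet s → List (Exp tm) → ℕ → ESet s
(X ⟨ P / x ⟩⦃0⦄ₛ) B = ∃[ A' ] ∃[ C ] (X A' × C ∈ lsubMany x P A' × B ∈ sub x [] C)

⋃Taylor : {s : Sort} → ESet s → Sum tm → ℕ → ESet s
⋃Taylor X 𝕄 x B = ∃[ P ] (TaySums 𝕄 P × (X ⟨ P / x ⟩⦃0⦄ₛ) B)

-- For (i), A⟨N/x⟩ and its Taylor counterpart both act on a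
-- single occurrence of x.  The one non-structural case is the promoted part of a bag: there
-- A⟨N/x⟩ extracts one copy of a summand of the promoted sum, matched on the Taylor side by one
-- element of the multiset, so the two sides agree only up to rearranging bags.
-- For (ii), an element of 𝒯(A{𝕄/x}) picks an element of 𝒯(𝕄) for each occurrence of x in some
-- A' ∈ 𝒯(A); the multiset P of these picks exhibits it as a summand of A'⟨P/x⟩, the iterated
-- linear substitution distributing P over subterms along interleavings.  Conversely, if P has
-- too few items an occurrence of x survives and {0/x} kills the summand, and a surplus item would
-- have to be substituted into an element of 𝒯(𝕄), which does not contain x, giving 0.  Taylor
-- elements being promotion-free, {0/x} leaves the remaining summands unchanged.

module Submission where

open import Defs
open import Data.Nat using (ℕ; suc; _<ᵇ_; _≡ᵇ_; _≤_; s≤s; z≤n)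
open import Data.Nat.Properties using (≡ᵇ⇒≡; ≡⇒≡ᵇ; <ᵇ⇒<; <⇒≱; m≤n⇒m≤1+n)
open import Data.Bool using (true; false; T)
open import Data.Unit using (tt)
open import Data.List using (List; []; _∷_; _++_; map; concatMap)
open import Data.List.Properties using (++-assoc)
open import Data.List.Relation.Unary.Any using (here; there)
open import Data.List.Relation.Unary.All as All using (All)
open import Data.List.Relation.Unary.All.Properties using () renaming (map⁺ to All-map⁺)
open import Data.List.Membership.Propositional using (_∈_; find; lose)
open import Data.List.Membership.Propositional.Properties
  using (∈-++⁺ˡ; ∈-++⁺ʳ; ∈-++⁻; ∈-map⁺; ∈-map⁻; ∈-concatMap⁺; ∈-concatMap⁻)
open import Data.List.Relation.Ternary.Interleaving.Propositional
  using (Interleaving; []; consˡ; consʳ)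
open import Data.Product using (_×_; _,_; ∃-syntax)
open import Data.Sum using (_⊎_; inj₁; inj₂)
open import Data.Empty using (⊥-elim)
open import Function using (_∘_)
open import Relation.Nullary using (¬_)
open import Relation.Binary.PropositionalEquality using (_≡_; _≢_; refl; sym; cong; subst; subst₂)

∈-concatMap⁺′ : ∀ {A B : Set} (f : A → List B) {x xs y} → x ∈ xs → y ∈ f x → y ∈ concatMap f xs
∈-concatMap⁺′ f x∈xs y∈fx = ∈-concatMap⁺ f (lose x∈xs y∈fx)

∈-concatMap⁻′ : ∀ {A B : Set} (f : A → List B) xs {y} → y ∈ concatMap f xs → ∃[ x ] (x ∈ xs × y ∈ f x)
∈-concatMap⁻′ f xs y∈ = find (∈-concatMap⁻ f y∈)

interleaving-[]ˡ : ∀ {A : Set} (ys : List A) → Interleaving [] ys ys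
interleaving-[]ˡ []       = []
interleaving-[]ˡ (y ∷ ys) = consʳ (interleaving-[]ˡ ys)

interleaving-++ : ∀ {A : Set} (xs ys : List A) → Interleaving xs ys (xs ++ ys)
interleaving-++ []       ys = interleaving-[]ˡ ys
interleaving-++ (x ∷ xs) ys = consˡ (interleaving-++ xs ys)

interleaving-++ʳ : ∀ {A : Set} {xs ys zs : List A} → Interleaving xs ys zs → ∀ ws → Interleaving xs (ys ++ ws) (zs ++ ws)
interleaving-++ʳ []         ws = interleaving-[]ˡ ws
interleaving-++ʳ (consˡ i) ws = consˡ (interleaving-++ʳ i ws)
interleaving-++ʳ (consʳ i) ws = consʳ (interleaving-++ʳ i ws)

interleaving-reassoc : ∀ {A : Set} {as bs cs bs₁ bs₂ : List A}
  → Interleaving as bs cs → Interleaving bs₁ bs₂ bs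
  → ∃[ ds ] (Interleaving as bs₁ ds × Interleaving ds bs₂ cs)
interleaving-reassoc []        []        = [] , [] , []
interleaving-reassoc (consˡ i) j         with interleaving-reassoc i j
... | ds , i₁ , i₂ = _ , consˡ i₁ , consˡ i₂
interleaving-reassoc (consʳ i) (consˡ j) with interleaving-reassoc i j
... | ds , i₁ , i₂ = _ , consʳ i₁ , consˡ i₂
interleaving-reassoc (consʳ i) (consʳ j) with interleaving-reassoc i j
... | ds , i₁ , i₂ = _ , i₁ , consʳ i₂

taySum⁻ : ∀ {s} {S : Sum s} {B} → TaySum S B → ∃[ A ] (A ∈ S × Tay A B)
taySum⁻ (here t)  = _ , here refl , t
taySum⁻ (there p) with taySum⁻ p
... | A , A∈S , t = A , there A∈S , t

taySum⁺ : ∀ {s} {S : Sum s} {A B} → A ∈ S → Tay A B → TaySum S B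
taySum⁺ (here refl) t = here t
taySum⁺ (there A∈S) t = there (taySum⁺ A∈S t)

tayL-++⁺ : ∀ {Xs Ys Zs Ws} → TayL Xs Zs → TayL Ys Ws → TayL (Xs ++ Ys) (Zs ++ Ws)
tayL-++⁺ []        u = u
tayL-++⁺ (t ∷ ts′) u = t ∷ tayL-++⁺ ts′ u

tayL-++⁻ : ∀ Xs {Ys Zs} → TayL (Xs ++ Ys) Zs
  → ∃[ Zs₁ ] ∃[ Zs₂ ] (Zs ≡ Zs₁ ++ Zs₂ × TayL Xs Zs₁ × TayL Ys Zs₂)
tayL-++⁻ []       t = [] , _ , refl , [] , t
tayL-++⁻ (X ∷ Xs) (t ∷ ts′) with tayL-++⁻ Xs ts′
... | Zs₁ , Zs₂ , refl , u , v = _ ∷ Zs₁ , Zs₂ , refl , t ∷ u , v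

taySums-++⁺ : ∀ {S Xs Ys} → TaySums S Xs → TaySums S Ys → TaySums S (Xs ++ Ys)
taySums-++⁺ []        u = u
taySums-++⁺ (t ∷ ts′) u = t ∷ taySums-++⁺ ts′ u

taySums-++⁻ : ∀ {S} Xs {Ys} → TaySums S (Xs ++ Ys) → TaySums S Xs × TaySums S Ys
taySums-++⁻ []       u = [] , u
taySums-++⁻ (X ∷ Xs) (t ∷ ts′) with taySums-++⁻ Xs ts′
... | u , v = t ∷ u , v

taySums-interleaving⁻ : ∀ {S P P₁ P₂} → TaySums S P → Interleaving P₁ P₂ P → TaySums S P₁ × TaySums S P₂
taySums-interleaving⁻ []        []        = [] , []
taySums-interleaving⁻ (t ∷ ts′) (consˡ i) with taySums-interleaving⁻ ts′ i
... | u , v = t ∷ u , v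
taySums-interleaving⁻ (t ∷ ts′) (consʳ i) with taySums-interleaving⁻ ts′ i
... | u , v = u , t ∷ v

mutual
  ≈-refl : ∀ {s} (A : Exp s) → A ≈ A
  ≈-refl (var y)    = ≈var
  ≈-refl (lam M)    = ≈lam (≈-refl M)
  ≈-refl (app M P)  = ≈app (≈-refl M) (≈-refl P)
  ≈-refl (tbar V)   = ≈tbar (≈-refl V)
  ≈-refl (tau Ls)   = ≈tau (≋-refl Ls)
  ≈-refl (bag Ls S) =
    ≈bag (≋-refl Ls) (sumeq (λ M∈ → _ , M∈ , ∈⇒≈-refl S M∈) (λ M∈ → _ , M∈ , ∈⇒≈-refl S M∈))

  ≋-refl : ∀ Ls → Ls ≋ Ls
  ≋-refl []       = []
  ≋-refl (L ∷ Ls) = ≈-refl L ∷ ≋-refl Ls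

  ∈⇒≈-refl : ∀ S {M} → M ∈ S → M ≈ M
  ∈⇒≈-refl (M ∷ S) (here refl) = ≈-refl M
  ∈⇒≈-refl (M ∷ S) (there M∈)  = ∈⇒≈-refl S M∈

≈ₛ-[] : [] ≈ₛ []
≈ₛ-[] = sumeq (λ ()) (λ ())

≋-++⁺ˡ : ∀ Xs {Ys Zs} → Ys ≋ Zs → (Xs ++ Ys) ≋ (Xs ++ Zs)
≋-++⁺ˡ []       e = e
≋-++⁺ˡ (X ∷ Xs) e = ≈-refl X ∷ ≋-++⁺ˡ Xs e

≋-++⁺ʳ : ∀ {Ys Zs} Ws → Ys ≋ Zs → (Ys ++ Ws) ≋ (Zs ++ Ws)
≋-++⁺ʳ Ws []          = ≋-refl Ws
≋-++⁺ʳ Ws (e ∷ es)    = e ∷ ≋-++⁺ʳ Ws es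
≋-++⁺ʳ Ws swap        = swap
≋-++⁺ʳ Ws (trans e f) = trans (≋-++⁺ʳ Ws e) (≋-++⁺ʳ Ws f)

≋-shift : ∀ {Q Q'} Xs Ys → Q ≈ Q' → (Q ∷ Xs ++ Ys) ≋ (Xs ++ Q' ∷ Ys)
≋-shift []       Ys e = e ∷ ≋-refl Ys
≋-shift (X ∷ Xs) Ys e = trans swap (≈-refl X ∷ ≋-shift Xs Ys e)

shiftL-++ : ∀ c Xs Ys → shiftL c (Xs ++ Ys) ≡ shiftL c Xs ++ shiftL c Ys
shiftL-++ c []       Ys = refl
shiftL-++ c (X ∷ Xs) Ys = cong (shift c X ∷_) (shiftL-++ c Xs Ys)

shiftL≗map : ∀ c Xs → shiftL c Xs ≡ map (shift c) Xs
shiftL≗map c []       = refl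
shiftL≗map c (X ∷ Xs) = cong (shift c X ∷_) (shiftL≗map c Xs)

mutual
  tay-shift⁺ : ∀ {s} c {A B : Exp s} → Tay A B → Tay (shift c A) (shift c B)
  tay-shift⁺ c (tvar {y}) with y <ᵇ c
  ... | true  = tvar
  ... | false = tvar
  tay-shift⁺ c (tlam t)   = tlam (tay-shift⁺ (suc c) t)
  tay-shift⁺ c (tapp t u) = tapp (tay-shift⁺ c t) (tay-shift⁺ c u)
  tay-shift⁺ c (ttbar t)  = ttbar (tay-shift⁺ c t)
  tay-shift⁺ c (ttau t)   = ttau (tayL-shift⁺ c t)
  tay-shift⁺ c (tbag {Ls' = Ls'} {Ps = Ps} t u) =
    subst (λ Bs → Tay _ (bag₀ Bs)) (sym (shiftL-++ c Ls' Ps)) (tbag (tayL-shift⁺ c t) (taySums-shift⁺ c u))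

  tayL-shift⁺ : ∀ c {Ls Ls'} → TayL Ls Ls' → TayL (shiftL c Ls) (shiftL c Ls')
  tayL-shift⁺ c []        = []
  tayL-shift⁺ c (t ∷ ts′) = tay-shift⁺ c t ∷ tayL-shift⁺ c ts′

  taySums-shift⁺ : ∀ c {S Ps} → TaySums S Ps → TaySums (shiftL c S) (shiftL c Ps)
  taySums-shift⁺ c []        = []
  taySums-shift⁺ c (t ∷ ts′) = taySum-shift⁺ c t ∷ taySums-shift⁺ c ts′

  taySum-shift⁺ : ∀ c {S Q} → TaySum S Q → TaySum (shiftL c S) (shift c Q)
  taySum-shift⁺ c (here t)  = here (tay-shift⁺ c t)
  taySum-shift⁺ c (there t) = there (taySum-shift⁺ c t)

tay-shift-var : ∀ c y {B} → Tay (shift c (var y)) B → B ≡ shift c (var y)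
tay-shift-var c y t with y <ᵇ c
tay-shift-var c y tvar | true  = refl
tay-shift-var c y tvar | false = refl

mutual
  tay-shift⁻ : ∀ {s} c (A : Exp s) {B} → Tay (shift c A) B → ∃[ B₀ ] (B ≡ shift c B₀ × Tay A B₀)
  tay-shift⁻ c (var y) t = var y , tay-shift-var c y t , tvar
  tay-shift⁻ c (lam M) (tlam t) with tay-shift⁻ (suc c) M t
  ... | B₀ , refl , t₀ = lam B₀ , refl , tlam t₀
  tay-shift⁻ c (app M P) (tapp t u) with tay-shift⁻ c M t | tay-shift⁻ c P u
  ... | B₀ , refl , t₀ | C₀ , refl , u₀ = app B₀ C₀ , refl , tapp t₀ u₀
  tay-shift⁻ c (tbar V) (ttbar t) with tay-shift⁻ c V t
  ... | B₀ , refl , t₀ = tbar B₀ , refl , ttbar t₀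
  tay-shift⁻ c (tau Ls) (ttau t) with tayL-shift⁻ c Ls t
  ... | Bs₀ , refl , t₀ = tau Bs₀ , refl , ttau t₀
  tay-shift⁻ c (bag Ls S) (tbag t u) with tayL-shift⁻ c Ls t | taySums-shift⁻ c S u
  ... | Bs₀ , refl , t₀ | Ps₀ , refl , u₀ =
    bag₀ (Bs₀ ++ Ps₀) , cong bag₀ (sym (shiftL-++ c Bs₀ Ps₀)) , tbag t₀ u₀

  tayL-shift⁻ : ∀ c Ls {Ls'} → TayL (shiftL c Ls) Ls' → ∃[ Bs₀ ] (Ls' ≡ shiftL c Bs₀ × TayL Ls Bs₀)
  tayL-shift⁻ c []       []        = [] , refl , []
  tayL-shift⁻ c (L ∷ Ls) (t ∷ ts′) with tay-shift⁻ c L t | tayL-shift⁻ c Ls ts′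
  ... | B₀ , refl , t₀ | Bs₀ , refl , ts₀ = B₀ ∷ Bs₀ , refl , t₀ ∷ ts₀

  taySums-shift⁻ : ∀ c S {Ps} → TaySums (shiftL c S) Ps → ∃[ Ps₀ ] (Ps ≡ shiftL c Ps₀ × TaySums S Ps₀)
  taySums-shift⁻ c S []        = [] , refl , []
  taySums-shift⁻ c S (t ∷ ts′) with taySum-shift⁻ c S t | taySums-shift⁻ c S ts′
  ... | Q₀ , refl , t₀ | Ps₀ , refl , ts₀ = Q₀ ∷ Ps₀ , refl , t₀ ∷ ts₀

  taySum-shift⁻ : ∀ c S {Q} → TaySum (shiftL c S) Q → ∃[ Q₀ ] (Q ≡ shift c Q₀ × TaySum S Q₀)
  taySum-shift⁻ c (M ∷ S) (here t) with tay-shift⁻ c M t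
  ... | Q₀ , eq , t₀ = Q₀ , eq , here t₀
  taySum-shift⁻ c (M ∷ S) (there t) with taySum-shift⁻ c S t
  ... | Q₀ , eq , t₀ = Q₀ , eq , there t₀

taySums-map-shift⁺ : ∀ {𝕄 P} → TaySums 𝕄 P → TaySums (map (shift 0) 𝕄) (map (shift 0) P)
taySums-map-shift⁺ {𝕄} {P} t = subst₂ TaySums (shiftL≗map 0 𝕄) (shiftL≗map 0 P) (taySums-shift⁺ 0 t)

taySums-map-shift⁻ : ∀ 𝕄 {P'} → TaySums (map (shift 0) 𝕄) P' → ∃[ P ] (P' ≡ map (shift 0) P × TaySums 𝕄 P)
taySums-map-shift⁻ 𝕄 t with taySums-shift⁻ 0 𝕄 (subst (λ S → TaySums S _) (sym (shiftL≗map 0 𝕄)) t)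
... | P , refl , u = P , shiftL≗map 0 P , u

lsub-var⁻ : ∀ {x y N B} → B ∈ lsub x N (var y) → y ≡ x × B ≡ N
lsub-var⁻ {x} {y} B∈ with y ≡ᵇ x | ≡ᵇ⇒≡ y x
lsub-var⁻ (here refl) | true | y≡x = y≡x tt , refl

lsub-var-self : ∀ x N → N ∈ lsub x N (var x)
lsub-var-self x N with x ≡ᵇ x | ≡⇒≡ᵇ x x refl
... | true | _ = here refl

module _ {x : ℕ} {N : Exp tm} where

  lsub-app⁻ : ∀ {M P C} → C ∈ lsub x N (app M P)
    → ∃[ M' ] (M' ∈ lsub x N M × C ≡ app M' P) ⊎ ∃[ P' ] (P' ∈ lsub x N P × C ≡ app M P')
  lsub-app⁻ {M} {P} C∈ with ∈-++⁻ (map (λ M' → app M' P) (lsub x N M)) C∈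
  ... | inj₁ C∈ˡ = inj₁ (∈-map⁻ _ C∈ˡ)
  ... | inj₂ C∈ʳ = inj₂ (∈-map⁻ _ C∈ʳ)

  lsub-appˡ⁺ : ∀ {M M' P} → M' ∈ lsub x N M → app M' P ∈ lsub x N (app M P)
  lsub-appˡ⁺ M'∈ = ∈-++⁺ˡ (∈-map⁺ _ M'∈)

  lsub-appʳ⁺ : ∀ {M P P'} → P' ∈ lsub x N P → app M P' ∈ lsub x N (app M P)
  lsub-appʳ⁺ {M} {P} P'∈ = ∈-++⁺ʳ (map (λ M' → app M' P) (lsub x N M)) (∈-map⁺ _ P'∈)

  lsub-bag⁻ : ∀ {Ls S C} → C ∈ lsub x N (bag Ls S)
    → ∃[ Ls' ] (Ls' ∈ lsubL x N Ls × C ≡ bag Ls' S) ⊎ ∃[ M' ] (M' ∈ lsubS x N S × C ≡ bag (Ls ++ M' ∷ []) S)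
  lsub-bag⁻ {Ls} {S} C∈ with ∈-++⁻ (map (λ Ls' → bag Ls' S) (lsubL x N Ls)) C∈
  ... | inj₁ C∈ˡ = inj₁ (∈-map⁻ _ C∈ˡ)
  ... | inj₂ C∈ʳ = inj₂ (∈-map⁻ _ C∈ʳ)

  lsub-bagˡ⁺ : ∀ {Ls Ls' S} → Ls' ∈ lsubL x N Ls → bag Ls' S ∈ lsub x N (bag Ls S)
  lsub-bagˡ⁺ Ls'∈ = ∈-++⁺ˡ (∈-map⁺ _ Ls'∈)

  lsub-bagʳ⁺ : ∀ {Ls S M'} → M' ∈ lsubS x N S → bag (Ls ++ M' ∷ []) S ∈ lsub x N (bag Ls S)
  lsub-bagʳ⁺ {Ls} {S} M'∈ = ∈-++⁺ʳ (map (λ Ls' → bag Ls' S) (lsubL x N Ls)) (∈-map⁺ _ M'∈)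

  lsubL-∷⁻ : ∀ {L Ls Cs} → Cs ∈ lsubL x N (L ∷ Ls)
    → ∃[ L' ] (L' ∈ lsub x N L × Cs ≡ L' ∷ Ls) ⊎ ∃[ Ls' ] (Ls' ∈ lsubL x N Ls × Cs ≡ L ∷ Ls')
  lsubL-∷⁻ {L} {Ls} Cs∈ with ∈-++⁻ (map (_∷ Ls) (lsub x N L)) Cs∈
  ... | inj₁ Cs∈ˡ = inj₁ (∈-map⁻ _ Cs∈ˡ)
  ... | inj₂ Cs∈ʳ = inj₂ (∈-map⁻ _ Cs∈ʳ)

  lsubL-here⁺ : ∀ {L L' Ls} → L' ∈ lsub x N L → (L' ∷ Ls) ∈ lsubL x N (L ∷ Ls)
  lsubL-here⁺ L'∈ = ∈-++⁺ˡ (∈-map⁺ _ L'∈)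

  lsubL-there⁺ : ∀ {L Ls Ls'} → Ls' ∈ lsubL x N Ls → (L ∷ Ls') ∈ lsubL x N (L ∷ Ls)
  lsubL-there⁺ {L} {Ls} Ls'∈ = ∈-++⁺ʳ (map (_∷ Ls) (lsub x N L)) (∈-map⁺ _ Ls'∈)

  lsubL-++⁺ˡ : ∀ Ls Ys {Cs} → Cs ∈ lsubL x N Ls → (Cs ++ Ys) ∈ lsubL x N (Ls ++ Ys)
  lsubL-++⁺ˡ (L ∷ Ls) Ys Cs∈ with lsubL-∷⁻ {L} {Ls} Cs∈
  ... | inj₁ (L' , L'∈ , refl) = lsubL-here⁺ L'∈
  ... | inj₂ (Ls' , Ls'∈ , refl) = lsubL-there⁺ (lsubL-++⁺ˡ Ls Ys Ls'∈)

  lsubL-++⁺ʳ : ∀ Xs {Ys Cs} → Cs ∈ lsubL x N Ys → (Xs ++ Cs) ∈ lsubL x N (Xs ++ Ys)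
  lsubL-++⁺ʳ []       Cs∈ = Cs∈
  lsubL-++⁺ʳ (X ∷ Xs) Cs∈ = lsubL-there⁺ (lsubL-++⁺ʳ Xs Cs∈)

  lsubL-++⁻ : ∀ Xs {Ys Cs} → Cs ∈ lsubL x N (Xs ++ Ys)
    → ∃[ Cs₁ ] (Cs₁ ∈ lsubL x N Xs × Cs ≡ Cs₁ ++ Ys) ⊎ ∃[ Cs₂ ] (Cs₂ ∈ lsubL x N Ys × Cs ≡ Xs ++ Cs₂)
  lsubL-++⁻ []       Cs∈ = inj₂ (_ , Cs∈ , refl)
  lsubL-++⁻ (X ∷ Xs) {Ys} Cs∈ with lsubL-∷⁻ {X} {Xs ++ Ys} Cs∈
  ... | inj₁ (X' , X'∈ , refl) = inj₁ (X' ∷ Xs , lsubL-here⁺ X'∈ , refl)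
  ... | inj₂ (Cs' , Cs'∈ , refl) with lsubL-++⁻ Xs Cs'∈
  ...   | inj₁ (Cs₁ , Cs₁∈ , refl) = inj₁ (X ∷ Cs₁ , lsubL-there⁺ Cs₁∈ , refl)
  ...   | inj₂ (Cs₂ , Cs₂∈ , refl) = inj₂ (Cs₂ , Cs₂∈ , refl)

  lsubL-focus : ∀ Ys {Cs} → Cs ∈ lsubL x N Ys
    → ∃[ Ys₁ ] ∃[ Y ] ∃[ Ys₂ ] ∃[ Y' ] (Ys ≡ Ys₁ ++ Y ∷ Ys₂ × Cs ≡ Ys₁ ++ Y' ∷ Ys₂ × Y' ∈ lsub x N Y)
  lsubL-focus (Y ∷ Ys) Cs∈ with lsubL-∷⁻ {Y} {Ys} Cs∈
  ... | inj₁ (Y' , Y'∈ , refl) = [] , Y , Ys , Y' , refl , refl , Y'∈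
  ... | inj₂ (Cs' , Cs'∈ , refl) with lsubL-focus Ys Cs'∈
  ...   | Ys₁ , Z , Ys₂ , Z' , refl , refl , Z'∈ = Y ∷ Ys₁ , Z , Ys₂ , Z' , refl , refl , Z'∈

-- Taylor expansion commutes with linear substitution

mutual
  𝒯-lsub-⊆ : ∀ {s} (A : Exp s) x N {A₀ B} → A₀ ∈ lsub x N A → Tay A₀ B
    → ∃[ C ] ((𝒯 A ⟨ 𝒯 N / x ⟩ₛ) C × B ≈ C)
  𝒯-lsub-⊆ (var y) x N A₀∈ t with lsub-var⁻ {x} {y} A₀∈
  ... | refl , refl = _ , (var y , _ , tvar , t , lsub-var-self y _) , ≈-refl _
  𝒯-lsub-⊆ (lam M) x N A₀∈ t with ∈-map⁻ lam A₀∈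
  𝒯-lsub-⊆ (lam M) x N _ (tlam t) | M₀ , M₀∈ , refl with 𝒯-lsub-⊆ M (suc x) (shift 0 N) M₀∈ t
  ... | C , (M' , N↑ , tM , tN↑ , C∈) , e with tay-shift⁻ 0 N tN↑
  ...   | N' , refl , tN = lam C , (lam M' , N' , tlam tM , tN , ∈-map⁺ lam C∈) , ≈lam e
  𝒯-lsub-⊆ (app M P) x N A₀∈ t with lsub-app⁻ {M = M} {P} A₀∈
  𝒯-lsub-⊆ (app M P) x N _ (tapp t u) | inj₁ (M₀ , M₀∈ , refl) with 𝒯-lsub-⊆ M x N M₀∈ t
  ... | C , (M' , N' , tM , tN , C∈) , e =
    app C _ , (app M' _ , N' , tapp tM u , tN , lsub-appˡ⁺ C∈) , ≈app e (≈-refl _)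
  𝒯-lsub-⊆ (app M P) x N _ (tapp {M' = M'} t u) | inj₂ (P₀ , P₀∈ , refl) with 𝒯-lsub-⊆ P x N P₀∈ u
  ... | C , (P' , N' , tP , tN , C∈) , e =
    app M' C , (app M' P' , N' , tapp t tP , tN , lsub-appʳ⁺ C∈) , ≈app (≈-refl M') e
  𝒯-lsub-⊆ (tbar V) x N A₀∈ t with ∈-map⁻ tbar A₀∈
  𝒯-lsub-⊆ (tbar V) x N _ (ttbar t) | V₀ , V₀∈ , refl with 𝒯-lsub-⊆ V x N V₀∈ t
  ... | C , (V' , N' , tV , tN , C∈) , e = tbar C , (tbar V' , N' , ttbar tV , tN , ∈-map⁺ tbar C∈) , ≈tbar e
  𝒯-lsub-⊆ (tau Ls) x N A₀∈ t with ∈-map⁻ tau A₀∈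
  𝒯-lsub-⊆ (tau Ls) x N _ (ttau t) | Ls₀ , Ls₀∈ , refl with 𝒯-lsubL-⊆ Ls x N Ls₀∈ t
  ... | Ls' , N' , Cs , tLs , tN , Cs∈ , e = tau Cs , (tau Ls' , N' , ttau tLs , tN , ∈-map⁺ tau Cs∈) , ≈tau e
  𝒯-lsub-⊆ (bag Ls S) x N A₀∈ t with lsub-bag⁻ {Ls = Ls} {S} A₀∈
  𝒯-lsub-⊆ (bag Ls S) x N _ (tbag {Ps = Ps} t u) | inj₁ (Ls₀ , Ls₀∈ , refl) with 𝒯-lsubL-⊆ Ls x N Ls₀∈ t
  ... | Ls' , N' , Cs , tLs , tN , Cs∈ , e =
    bag₀ (Cs ++ Ps) , (bag₀ (Ls' ++ Ps) , N' , tbag tLs u , tN , lsub-bagˡ⁺ {Ls = Ls' ++ Ps} (lsubL-++⁺ˡ Ls' Ps Cs∈)) ,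
    ≈bag (≋-++⁺ʳ Ps e) ≈ₛ-[]
  𝒯-lsub-⊆ (bag Ls S) x N _ (tbag {Ps = Ps} t u) | inj₂ (M₀ , M₀∈ , refl) with tayL-++⁻ Ls t
  ... | Bs , Q ∷ [] , refl , tLs , tQ ∷ [] with 𝒯-lsubS-⊆ S x N M₀∈ tQ
  ...   | Q₀ , N' , Q' , tQ₀ , tN , Q'∈ , e =
    bag₀ (Bs ++ Q' ∷ Ps) ,
    (bag₀ (Bs ++ Q₀ ∷ Ps) , N' , tbag tLs (tQ₀ ∷ u) , tN ,
       lsub-bagˡ⁺ {Ls = Bs ++ Q₀ ∷ Ps} (lsubL-++⁺ʳ Bs (lsubL-here⁺ {Ls = Ps} Q'∈))) ,
    ≈bag (subst (_≋ (Bs ++ Q' ∷ Ps)) (sym (++-assoc Bs (Q ∷ []) Ps)) (≋-++⁺ˡ Bs (e ∷ ≋-refl Ps))) ≈ₛ-[]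

  𝒯-lsubL-⊆ : ∀ Ls x N {Ls₀ Bs} → Ls₀ ∈ lsubL x N Ls → TayL Ls₀ Bs
    → ∃[ Ls' ] ∃[ N' ] ∃[ Cs ] (TayL Ls Ls' × Tay N N' × Cs ∈ lsubL x N' Ls' × Bs ≋ Cs)
  𝒯-lsubL-⊆ (L ∷ Ls) x N Ls₀∈ t with lsubL-∷⁻ {L = L} {Ls} Ls₀∈
  𝒯-lsubL-⊆ (L ∷ Ls) x N _ (t ∷ ts′) | inj₁ (L₀ , L₀∈ , refl) with 𝒯-lsub-⊆ L x N L₀∈ t
  ... | C , (L' , N' , tL , tN , C∈) , e = L' ∷ _ , N' , C ∷ _ , tL ∷ ts′ , tN , lsubL-here⁺ C∈ , e ∷ ≋-refl _
  𝒯-lsubL-⊆ (L ∷ Ls) x N _ (_∷_ {L' = B} t ts′) | inj₂ (Ls₁ , Ls₁∈ , refl) with 𝒯-lsubL-⊆ Ls x N Ls₁∈ ts′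
  ... | Ls' , N' , Cs , tLs , tN , Cs∈ , e = B ∷ Ls' , N' , B ∷ Cs , t ∷ tLs , tN , lsubL-there⁺ Cs∈ , ≈-refl B ∷ e

  𝒯-lsubS-⊆ : ∀ S x N {M₀ Q} → M₀ ∈ lsubS x N S → Tay M₀ Q
    → ∃[ Q₀ ] ∃[ N' ] ∃[ Q' ] (TaySum S Q₀ × Tay N N' × Q' ∈ lsub x N' Q₀ × Q ≈ Q')
  𝒯-lsubS-⊆ (M ∷ S) x N M₀∈ t with ∈-++⁻ (lsub x N M) M₀∈
  ... | inj₁ M₀∈ˡ with 𝒯-lsub-⊆ M x N M₀∈ˡ t
  ...   | C , (M' , N' , tM , tN , C∈) , e = M' , N' , C , here tM , tN , C∈ , e
  𝒯-lsubS-⊆ (M ∷ S) x N M₀∈ t | inj₂ M₀∈ʳ with 𝒯-lsubS-⊆ S x N M₀∈ʳ t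
  ...   | Q₀ , N' , Q' , tQ₀ , tN , Q'∈ , e = Q₀ , N' , Q' , there tQ₀ , tN , Q'∈ , e

mutual
  𝒯-lsub-⊇ : ∀ {s} (A : Exp s) x N {A' N' C} → Tay A A' → Tay N N' → C ∈ lsub x N' A'
    → ∃[ A₀ ] ∃[ B ] (A₀ ∈ lsub x N A × Tay A₀ B × B ≈ C)
  𝒯-lsub-⊇ (var y) x N tvar tN C∈ with lsub-var⁻ {x} {y} C∈
  ... | refl , refl = N , _ , lsub-var-self y N , tN , ≈-refl _
  𝒯-lsub-⊇ (lam M) x N (tlam tM) tN C∈ with ∈-map⁻ lam C∈
  ... | C₀ , C₀∈ , refl with 𝒯-lsub-⊇ M (suc x) (shift 0 N) tM (tay-shift⁺ 0 tN) C₀∈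
  ...   | M₀ , B , M₀∈ , t , e = lam M₀ , lam B , ∈-map⁺ lam M₀∈ , tlam t , ≈lam e
  𝒯-lsub-⊇ (app M P) x N (tapp {M' = M'} {P' = P'} tM tP) tN C∈ with lsub-app⁻ {M = M'} {P'} C∈
  ... | inj₁ (C₁ , C₁∈ , refl) with 𝒯-lsub-⊇ M x N tM tN C₁∈
  ...   | M₀ , B , M₀∈ , t , e = app M₀ P , app B P' , lsub-appˡ⁺ M₀∈ , tapp t tP , ≈app e (≈-refl P')
  𝒯-lsub-⊇ (app M P) x N (tapp {M' = M'} tM tP) tN C∈ | inj₂ (C₂ , C₂∈ , refl) with 𝒯-lsub-⊇ P x N tP tN C₂∈
  ...   | P₀ , B , P₀∈ , t , e = app M P₀ , app M' B , lsub-appʳ⁺ P₀∈ , tapp tM t , ≈app (≈-refl M') e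
  𝒯-lsub-⊇ (tbar V) x N (ttbar tV) tN C∈ with ∈-map⁻ tbar C∈
  ... | C₀ , C₀∈ , refl with 𝒯-lsub-⊇ V x N tV tN C₀∈
  ...   | V₀ , B , V₀∈ , t , e = tbar V₀ , tbar B , ∈-map⁺ tbar V₀∈ , ttbar t , ≈tbar e
  𝒯-lsub-⊇ (tau Ls) x N (ttau tLs) tN C∈ with ∈-map⁻ tau C∈
  ... | Cs , Cs∈ , refl with 𝒯-lsubL-⊇ Ls x N tLs tN Cs∈
  ...   | Ls₀ , Bs , Ls₀∈ , t , e = tau Ls₀ , tau Bs , ∈-map⁺ tau Ls₀∈ , ttau t , ≈tau e
  𝒯-lsub-⊇ (bag Ls S) x N (tbag {Ls' = Ls'} {Ps = Ps} tLs tPs) tN C∈ with lsub-bag⁻ {Ls = Ls' ++ Ps} {[]} C∈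
  ... | inj₂ (_ , () , _)
  ... | inj₁ (Cs , Cs∈ , refl) with lsubL-++⁻ Ls' Cs∈
  ...   | inj₁ (Cs₁ , Cs₁∈ , refl) with 𝒯-lsubL-⊇ Ls x N tLs tN Cs₁∈
  ...     | Ls₀ , Bs , Ls₀∈ , t , e =
    bag Ls₀ S , bag₀ (Bs ++ Ps) , lsub-bagˡ⁺ Ls₀∈ , tbag t tPs , ≈bag (≋-++⁺ʳ Ps e) ≈ₛ-[]
  𝒯-lsub-⊇ (bag Ls S) x N (tbag {Ls' = Ls'} {Ps = Ps} tLs tPs) tN C∈ | inj₁ (Cs , Cs∈ , refl) | inj₂ (Cs₂ , Cs₂∈ , refl)
    with lsubL-focus Ps Cs₂∈
  ... | Ps₁ , Y , Ps₂ , Y' , refl , refl , Y'∈ with taySums-++⁻ Ps₁ tPs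
  ...   | tPs₁ , tY ∷ tPs₂ with 𝒯-lsubS-⊇ S x N tY tN Y'∈
  ...     | M₀ , Q , M₀∈ , tQ , e =
    bag (Ls ++ M₀ ∷ []) S , bag₀ ((Ls' ++ Q ∷ []) ++ Ps₁ ++ Ps₂) , lsub-bagʳ⁺ M₀∈ ,
    tbag (tayL-++⁺ tLs (tQ ∷ [])) (taySums-++⁺ tPs₁ tPs₂) ,
    ≈bag (subst (_≋ (Ls' ++ Ps₁ ++ Y' ∷ Ps₂)) (sym (++-assoc Ls' (Q ∷ []) (Ps₁ ++ Ps₂)))
                (≋-++⁺ˡ Ls' (≋-shift Ps₁ Ps₂ e)))
         ≈ₛ-[]

  𝒯-lsubL-⊇ : ∀ Ls x N {Ls' N' Cs} → TayL Ls Ls' → Tay N N' → Cs ∈ lsubL x N' Ls'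
    → ∃[ Ls₀ ] ∃[ Bs ] (Ls₀ ∈ lsubL x N Ls × TayL Ls₀ Bs × Bs ≋ Cs)
  𝒯-lsubL-⊇ (L ∷ Ls) x N (_∷_ {L' = L'} {Ls' = Ls'} tL tLs) tN Cs∈ with lsubL-∷⁻ {L = L'} {Ls'} Cs∈
  ... | inj₁ (C , C∈ , refl) with 𝒯-lsub-⊇ L x N tL tN C∈
  ...   | L₀ , B , L₀∈ , t , e = L₀ ∷ Ls , B ∷ Ls' , lsubL-here⁺ L₀∈ , t ∷ tLs , e ∷ ≋-refl Ls'
  𝒯-lsubL-⊇ (L ∷ Ls) x N (_∷_ {L' = L'} tL tLs) tN Cs∈ | inj₂ (Cs' , Cs'∈ , refl) with 𝒯-lsubL-⊇ Ls x N tLs tN Cs'∈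
  ...   | Ls₀ , Bs , Ls₀∈ , t , e = L ∷ Ls₀ , L' ∷ Bs , lsubL-there⁺ Ls₀∈ , tL ∷ t , ≈-refl L' ∷ e

  𝒯-lsubS-⊇ : ∀ S x N {Y N' Y'} → TaySum S Y → Tay N N' → Y' ∈ lsub x N' Y
    → ∃[ M₀ ] ∃[ Q ] (M₀ ∈ lsubS x N S × Tay M₀ Q × Q ≈ Y')
  𝒯-lsubS-⊇ (M ∷ S) x N (here tM) tN Y'∈ with 𝒯-lsub-⊇ M x N tM tN Y'∈
  ... | M₀ , Q , M₀∈ , t , e = M₀ , Q , ∈-++⁺ˡ M₀∈ , t , e
  𝒯-lsubS-⊇ (M ∷ S) x N (there tS) tN Y'∈ with 𝒯-lsubS-⊇ S x N tS tN Y'∈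
  ... | M₀ , Q , M₀∈ , t , e = M₀ , Q , ∈-++⁺ʳ (lsub x N M) M₀∈ , t , e

module _ {x : ℕ} {𝕄 : Sum tm} where

  sub-var⁻ : ∀ {y B} → B ∈ sub x 𝕄 (var y) → y ≡ x × B ∈ 𝕄 ⊎ y ≢ x × B ≡ var y
  sub-var⁻ {y} B∈ with y ≡ᵇ x | ≡ᵇ⇒≡ y x | ≡⇒≡ᵇ y x
  sub-var⁻ B∈          | true  | y≡x | _   = inj₁ (y≡x tt , B∈)
  sub-var⁻ (here refl) | false | _   | y≢x = inj₂ (y≢x , refl)

  sub-var-self⁺ : ∀ {M} → M ∈ 𝕄 → M ∈ sub x 𝕄 (var x)
  sub-var-self⁺ M∈ with x ≡ᵇ x | ≡⇒≡ᵇ x x refl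
  ... | true | _ = M∈

  sub-var-other⁺ : ∀ {y} → y ≢ x → var y ∈ sub x 𝕄 (var y)
  sub-var-other⁺ {y} y≢x with y ≡ᵇ x | ≡ᵇ⇒≡ y x
  ... | true  | y≡x = ⊥-elim (y≢x (y≡x tt))
  ... | false | _   = here refl

  sub-app⁻ : ∀ {M P C} → C ∈ sub x 𝕄 (app M P)
    → ∃[ M' ] ∃[ P' ] (C ≡ app M' P' × M' ∈ sub x 𝕄 M × P' ∈ sub x 𝕄 P)
  sub-app⁻ {M} {P} C∈ with ∈-concatMap⁻′ (λ M' → map (app M') (sub x 𝕄 P)) (sub x 𝕄 M) C∈
  ... | M' , M'∈ , C∈′ with ∈-map⁻ (app M') C∈′
  ...   | P' , P'∈ , refl = M' , P' , refl , M'∈ , P'∈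

  sub-app⁺ : ∀ {M P M' P'} → M' ∈ sub x 𝕄 M → P' ∈ sub x 𝕄 P → app M' P' ∈ sub x 𝕄 (app M P)
  sub-app⁺ {P = P} M'∈ P'∈ = ∈-concatMap⁺′ (λ M' → map (app M') (sub x 𝕄 P)) M'∈ (∈-map⁺ _ P'∈)

  subL-∷⁻ : ∀ {L Ls Cs} → Cs ∈ subL x 𝕄 (L ∷ Ls)
    → ∃[ L' ] ∃[ Ls' ] (Cs ≡ L' ∷ Ls' × L' ∈ sub x 𝕄 L × Ls' ∈ subL x 𝕄 Ls)
  subL-∷⁻ {L} {Ls} Cs∈ with ∈-concatMap⁻′ (λ L' → map (L' ∷_) (subL x 𝕄 Ls)) (sub x 𝕄 L) Cs∈
  ... | L' , L'∈ , Cs∈′ with ∈-map⁻ (L' ∷_) Cs∈′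
  ...   | Ls' , Ls'∈ , refl = L' , Ls' , refl , L'∈ , Ls'∈

  subL-∷⁺ : ∀ {L Ls L' Ls'} → L' ∈ sub x 𝕄 L → Ls' ∈ subL x 𝕄 Ls → (L' ∷ Ls') ∈ subL x 𝕄 (L ∷ Ls)
  subL-∷⁺ {Ls = Ls} L'∈ Ls'∈ = ∈-concatMap⁺′ (λ L' → map (L' ∷_) (subL x 𝕄 Ls)) L'∈ (∈-map⁺ _ Ls'∈)

freeL-++⁻ : ∀ {x} Xs {Ys} → FreeL x (Xs ++ Ys) → FreeL x Xs ⊎ FreeL x Ys
freeL-++⁻ []       f         = inj₂ f
freeL-++⁻ (X ∷ Xs) (here f)  = inj₁ (here f)
freeL-++⁻ (X ∷ Xs) (there f) with freeL-++⁻ Xs f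
... | inj₁ g = inj₁ (there g)
... | inj₂ g = inj₂ g

freeL-++⁺ˡ : ∀ {x Xs Ys} → FreeL x Xs → FreeL x (Xs ++ Ys)
freeL-++⁺ˡ (here f)  = here f
freeL-++⁺ˡ (there f) = there (freeL-++⁺ˡ f)

freeL-++⁺ʳ : ∀ {x} Xs {Ys} → FreeL x Ys → FreeL x (Xs ++ Ys)
freeL-++⁺ʳ []       f = f
freeL-++⁺ʳ (X ∷ Xs) f = there (freeL-++⁺ʳ Xs f)

freeL⁻ : ∀ {x Xs} → FreeL x Xs → ∃[ M ] (M ∈ Xs × Free x M)
freeL⁻ (here f)  = _ , here refl , f
freeL⁻ (there f) with freeL⁻ f
... | M , M∈ , g = M , there M∈ , g

mutual
  shift-Free⁻ : ∀ {s} c x (M : Exp s) → c ≤ x → Free (suc x) (shift c M) → Free x M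
  shift-Free⁻ c x (var y) c≤x f with y <ᵇ c in y<c
  shift-Free⁻ c x (var _) c≤x fvar | true  =
    ⊥-elim (<⇒≱ (<ᵇ⇒< (suc x) c (subst T (sym y<c) tt)) (m≤n⇒m≤1+n c≤x))
  shift-Free⁻ c x (var _) c≤x fvar | false = fvar
  shift-Free⁻ c x (lam M)    c≤x (flam f)  = flam (shift-Free⁻ (suc c) (suc x) M (s≤s c≤x) f)
  shift-Free⁻ c x (app M P)  c≤x (fappl f) = fappl (shift-Free⁻ c x M c≤x f)
  shift-Free⁻ c x (app M P)  c≤x (fappr f) = fappr (shift-Free⁻ c x P c≤x f)
  shift-Free⁻ c x (tbar V)   c≤x (ftbar f) = ftbar (shift-Free⁻ c x V c≤x f)
  shift-Free⁻ c x (tau Ls)   c≤x (ftau f)  = ftau (shiftL-FreeL⁻ c x Ls c≤x f)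
  shift-Free⁻ c x (bag Ls S) c≤x (fbagl f) = fbagl (shiftL-FreeL⁻ c x Ls c≤x f)
  shift-Free⁻ c x (bag Ls S) c≤x (fbagp f) = fbagp (shiftL-FreeL⁻ c x S c≤x f)

  shiftL-FreeL⁻ : ∀ c x Ls → c ≤ x → FreeL (suc x) (shiftL c Ls) → FreeL x Ls
  shiftL-FreeL⁻ c x (L ∷ Ls) c≤x (here f)  = here (shift-Free⁻ c x L c≤x f)
  shiftL-FreeL⁻ c x (L ∷ Ls) c≤x (there f) = there (shiftL-FreeL⁻ c x Ls c≤x f)

mutual
  tay-Free⁻ : ∀ {s x} {A B : Exp s} → Tay A B → Free x B → Free x A
  tay-Free⁻ tvar       f         = f
  tay-Free⁻ (tlam t)   (flam f)  = flam (tay-Free⁻ t f)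
  tay-Free⁻ (tapp t u) (fappl f) = fappl (tay-Free⁻ t f)
  tay-Free⁻ (tapp t u) (fappr f) = fappr (tay-Free⁻ u f)
  tay-Free⁻ (ttbar t)  (ftbar f) = ftbar (tay-Free⁻ t f)
  tay-Free⁻ (ttau t)   (ftau f)  = ftau (tayL-FreeL⁻ t f)
  tay-Free⁻ (tbag {Ls' = Ls'} t u) (fbagl f) with freeL-++⁻ Ls' f
  ... | inj₁ g = fbagl (tayL-FreeL⁻ t g)
  ... | inj₂ g = fbagp (taySums-FreeL⁻ u g)

  tayL-FreeL⁻ : ∀ {x Ls Ls'} → TayL Ls Ls' → FreeL x Ls' → FreeL x Ls
  tayL-FreeL⁻ (t ∷ ts′) (here f)  = here (tay-Free⁻ t f)
  tayL-FreeL⁻ (t ∷ ts′) (there f) = there (tayL-FreeL⁻ ts′ f)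

  taySums-FreeL⁻ : ∀ {x S Ps} → TaySums S Ps → FreeL x Ps → FreeL x S
  taySums-FreeL⁻ (t ∷ ts′) (here f)  = taySum-FreeL⁻ t f
  taySums-FreeL⁻ (t ∷ ts′) (there f) = taySums-FreeL⁻ ts′ f

  taySum-FreeL⁻ : ∀ {x S B} → TaySum S B → Free x B → FreeL x S
  taySum-FreeL⁻ (here t)  f = here (tay-Free⁻ t f)
  taySum-FreeL⁻ (there t) f = there (taySum-FreeL⁻ t f)

mutual
  lsub-Free : ∀ {s x N} (A : Exp s) {C} → C ∈ lsub x N A → Free x A
  lsub-Free {x = x} (var y) C∈ with lsub-var⁻ {x} {y} C∈
  ... | refl , _ = fvar
  lsub-Free (lam M) C∈ with ∈-map⁻ lam C∈
  ... | _ , C₀∈ , _ = flam (lsub-Free M C₀∈)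
  lsub-Free (app M P) C∈ with lsub-app⁻ {M = M} {P} C∈
  ... | inj₁ (_ , C₀∈ , _) = fappl (lsub-Free M C₀∈)
  ... | inj₂ (_ , C₀∈ , _) = fappr (lsub-Free P C₀∈)
  lsub-Free (tbar V) C∈ with ∈-map⁻ tbar C∈
  ... | _ , C₀∈ , _ = ftbar (lsub-Free V C₀∈)
  lsub-Free (tau Ls) C∈ with ∈-map⁻ tau C∈
  ... | _ , Cs∈ , _ = ftau (lsubL-FreeL Ls Cs∈)
  lsub-Free (bag Ls S) C∈ with lsub-bag⁻ {Ls = Ls} {S} C∈
  ... | inj₁ (_ , Cs∈ , _) = fbagl (lsubL-FreeL Ls Cs∈)
  ... | inj₂ (_ , C₀∈ , _) = fbagp (lsubS-FreeL S C₀∈)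

  lsubL-FreeL : ∀ {x N} Ls {Cs} → Cs ∈ lsubL x N Ls → FreeL x Ls
  lsubL-FreeL (L ∷ Ls) Cs∈ with lsubL-∷⁻ {L = L} {Ls} Cs∈
  ... | inj₁ (_ , C∈ , _)   = here (lsub-Free L C∈)
  ... | inj₂ (_ , Cs'∈ , _) = there (lsubL-FreeL Ls Cs'∈)

  lsubS-FreeL : ∀ {x N} S {C} → C ∈ lsubS x N S → FreeL x S
  lsubS-FreeL {x} {N} (M ∷ S) C∈ with ∈-++⁻ (lsub x N M) C∈
  ... | inj₁ C∈ˡ = here (lsub-Free M C∈ˡ)
  ... | inj₂ C∈ʳ = there (lsubS-FreeL S C∈ʳ)

¬Free-map-shift : ∀ {x} {𝕄 : Sum tm} → All (λ M → ¬ Free x M) 𝕄 → All (λ M → ¬ Free (suc x) M) (map (shift 0) 𝕄)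
¬Free-map-shift {x} h = All-map⁺ (All.map (λ {M} ¬f f → ¬f (shift-Free⁻ 0 x M z≤n f)) h)

mutual
  sub-¬Free : ∀ {s} (A : Exp s) x 𝕄 → All (λ M → ¬ Free x M) 𝕄 → ∀ {A₀} → A₀ ∈ sub x 𝕄 A → ¬ Free x A₀
  sub-¬Free (var y) x 𝕄 h A₀∈ with sub-var⁻ {x} {𝕄} {y} A₀∈
  ... | inj₁ (_ , A₀∈𝕄)    = All.lookup h A₀∈𝕄
  ... | inj₂ (y≢x , refl) = λ { fvar → y≢x refl }
  sub-¬Free (lam M) x 𝕄 h A₀∈ with ∈-map⁻ lam A₀∈
  ... | _ , M₀∈ , refl = λ { (flam f) → sub-¬Free M (suc x) (map (shift 0) 𝕄) (¬Free-map-shift h) M₀∈ f }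
  sub-¬Free (app M P) x 𝕄 h A₀∈ with sub-app⁻ {x} {𝕄} {M} {P} A₀∈
  ... | _ , _ , refl , M₀∈ , P₀∈ = λ { (fappl f) → sub-¬Free M x 𝕄 h M₀∈ f
                                     ; (fappr f) → sub-¬Free P x 𝕄 h P₀∈ f }
  sub-¬Free (tbar V) x 𝕄 h A₀∈ with ∈-map⁻ tbar A₀∈
  ... | _ , V₀∈ , refl = λ { (ftbar f) → sub-¬Free V x 𝕄 h V₀∈ f }
  sub-¬Free (tau Ls) x 𝕄 h A₀∈ with ∈-map⁻ tau A₀∈
  ... | _ , Ls₀∈ , refl = λ { (ftau f) → subL-¬FreeL Ls x 𝕄 h Ls₀∈ f }
  sub-¬Free (bag Ls S) x 𝕄 h A₀∈ with ∈-map⁻ (λ Ls' → bag Ls' (subS x 𝕄 S)) A₀∈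
  ... | _ , Ls₀∈ , refl = λ { (fbagl f) → subL-¬FreeL Ls x 𝕄 h Ls₀∈ f
                            ; (fbagp f) → let _ , M∈ , g = freeL⁻ f in subS-¬Free S x 𝕄 h M∈ g }

  subL-¬FreeL : ∀ Ls x 𝕄 → All (λ M → ¬ Free x M) 𝕄 → ∀ {Ls₀} → Ls₀ ∈ subL x 𝕄 Ls → ¬ FreeL x Ls₀
  subL-¬FreeL []       x 𝕄 h (here refl) ()
  subL-¬FreeL (L ∷ Ls) x 𝕄 h Ls₀∈ with subL-∷⁻ {x} {𝕄} {L} {Ls} Ls₀∈
  ... | _ , _ , refl , L₀∈ , Ls₁∈ = λ { (here f)  → sub-¬Free L x 𝕄 h L₀∈ f
                                      ; (there f) → subL-¬FreeL Ls x 𝕄 h Ls₁∈ f }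

  subS-¬Free : ∀ S x 𝕄 → All (λ M → ¬ Free x M) 𝕄 → ∀ {M₀} → M₀ ∈ subS x 𝕄 S → ¬ Free x M₀
  subS-¬Free (M ∷ S) x 𝕄 h M₀∈ with ∈-++⁻ (sub x 𝕄 M) M₀∈
  ... | inj₁ M₀∈ˡ = sub-¬Free M x 𝕄 h M₀∈ˡ
  ... | inj₂ M₀∈ʳ = subS-¬Free S x 𝕄 h M₀∈ʳ

-- Promotion-free expressions and substitution of 0

mutual
  data PromotionFree : {s : Sort} → Exp s → Set where
    pvar  : ∀ {y} → PromotionFree (var y)
    plam  : ∀ {M} → PromotionFree M → PromotionFree (lam M)
    papp  : ∀ {M P} → PromotionFree M → PromotionFree P → PromotionFree (app M P)
    ptbar : ∀ {V} → PromotionFree V → PromotionFree (tbar V)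
    ptau  : ∀ {Ls} → PromotionFreeL Ls → PromotionFree (tau Ls)
    pbag  : ∀ {Ls} → PromotionFreeL Ls → PromotionFree (bag₀ Ls)

  data PromotionFreeL : List (Exp tm) → Set where
    []  : PromotionFreeL []
    _∷_ : ∀ {L Ls} → PromotionFree L → PromotionFreeL Ls → PromotionFreeL (L ∷ Ls)

promotionFreeL-++ : ∀ {Xs Ys} → PromotionFreeL Xs → PromotionFreeL Ys → PromotionFreeL (Xs ++ Ys)
promotionFreeL-++ []       q = q
promotionFreeL-++ (p ∷ ps) q = p ∷ promotionFreeL-++ ps q

mutual
  𝒯-PromotionFree : ∀ {s} {A B : Exp s} → Tay A B → PromotionFree B
  𝒯-PromotionFree tvar       = pvar
  𝒯-PromotionFree (tlam t)   = plam (𝒯-PromotionFree t)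
  𝒯-PromotionFree (tapp t u) = papp (𝒯-PromotionFree t) (𝒯-PromotionFree u)
  𝒯-PromotionFree (ttbar t)  = ptbar (𝒯-PromotionFree t)
  𝒯-PromotionFree (ttau t)   = ptau (𝒯L-PromotionFreeL t)
  𝒯-PromotionFree (tbag t u) = pbag (promotionFreeL-++ (𝒯L-PromotionFreeL t) (𝒯Sums-PromotionFreeL u))

  𝒯L-PromotionFreeL : ∀ {Ls Ls'} → TayL Ls Ls' → PromotionFreeL Ls'
  𝒯L-PromotionFreeL []        = []
  𝒯L-PromotionFreeL (t ∷ ts′) = 𝒯-PromotionFree t ∷ 𝒯L-PromotionFreeL ts′

  𝒯Sums-PromotionFreeL : ∀ {S Ps} → TaySums S Ps → PromotionFreeL Ps
  𝒯Sums-PromotionFreeL []        = []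
  𝒯Sums-PromotionFreeL (t ∷ ts′) = 𝒯Sum-PromotionFree t ∷ 𝒯Sums-PromotionFreeL ts′

  𝒯Sum-PromotionFree : ∀ {s} {S : Sum s} {B} → TaySum S B → PromotionFree B
  𝒯Sum-PromotionFree (here t)  = 𝒯-PromotionFree t
  𝒯Sum-PromotionFree (there t) = 𝒯Sum-PromotionFree t

mutual
  shift-PromotionFree : ∀ {s} c {A : Exp s} → PromotionFree A → PromotionFree (shift c A)
  shift-PromotionFree c (pvar {y}) with y <ᵇ c
  ... | true  = pvar
  ... | false = pvar
  shift-PromotionFree c (plam p)   = plam (shift-PromotionFree (suc c) p)
  shift-PromotionFree c (papp p q) = papp (shift-PromotionFree c p) (shift-PromotionFree c q)
  shift-PromotionFree c (ptbar p)  = ptbar (shift-PromotionFree c p)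
  shift-PromotionFree c (ptau p)   = ptau (shiftL-PromotionFreeL c p)
  shift-PromotionFree c (pbag p)   = pbag (shiftL-PromotionFreeL c p)

  shiftL-PromotionFreeL : ∀ c {Ls} → PromotionFreeL Ls → PromotionFreeL (shiftL c Ls)
  shiftL-PromotionFreeL c []       = []
  shiftL-PromotionFreeL c (p ∷ ps) = shift-PromotionFree c p ∷ shiftL-PromotionFreeL c ps

mutual
  lsub-PromotionFree : ∀ {s x N} {A : Exp s} {C} → PromotionFree N → PromotionFree A → C ∈ lsub x N A → PromotionFree C
  lsub-PromotionFree {x = x} {A = var y} pN pvar C∈ with lsub-var⁻ {x} {y} C∈
  ... | refl , refl = pN
  lsub-PromotionFree pN (plam p) C∈ with ∈-map⁻ lam C∈
  ... | _ , C₀∈ , refl = plam (lsub-PromotionFree (shift-PromotionFree 0 pN) p C₀∈)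
  lsub-PromotionFree {A = app M P} pN (papp p q) C∈ with lsub-app⁻ {M = M} {P} C∈
  ... | inj₁ (_ , C₀∈ , refl) = papp (lsub-PromotionFree pN p C₀∈) q
  ... | inj₂ (_ , C₀∈ , refl) = papp p (lsub-PromotionFree pN q C₀∈)
  lsub-PromotionFree pN (ptbar p) C∈ with ∈-map⁻ tbar C∈
  ... | _ , C₀∈ , refl = ptbar (lsub-PromotionFree pN p C₀∈)
  lsub-PromotionFree pN (ptau p) C∈ with ∈-map⁻ tau C∈
  ... | _ , Cs∈ , refl = ptau (lsubL-PromotionFreeL pN p Cs∈)
  lsub-PromotionFree {A = bag Ls []} pN (pbag p) C∈ with lsub-bag⁻ {Ls = Ls} {[]} C∈
  ... | inj₁ (_ , Cs∈ , refl) = pbag (lsubL-PromotionFreeL pN p Cs∈)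
  ... | inj₂ (_ , () , _)

  lsubL-PromotionFreeL : ∀ {x N Ls Cs} → PromotionFree N → PromotionFreeL Ls → Cs ∈ lsubL x N Ls → PromotionFreeL Cs
  lsubL-PromotionFreeL {Ls = L ∷ Ls} pN (p ∷ ps) Cs∈ with lsubL-∷⁻ {L = L} {Ls} Cs∈
  ... | inj₁ (_ , C∈ , refl)   = lsub-PromotionFree pN p C∈ ∷ ps
  ... | inj₂ (_ , Cs'∈ , refl) = p ∷ lsubL-PromotionFreeL pN ps Cs'∈

lsubMany-PromotionFree : ∀ {s x P} {A : Exp s} {C} → PromotionFreeL P → PromotionFree A → C ∈ lsubMany x P A → PromotionFree C
lsubMany-PromotionFree []                   pA (here refl) = pA
lsubMany-PromotionFree {x = x} {L ∷ P} {A} (pL ∷ pP) pA C∈ with ∈-concatMap⁻′ (lsubMany x P) (lsub x L A) C∈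
... | A₁ , A₁∈ , C∈′ = lsubMany-PromotionFree pP (lsub-PromotionFree pL pA A₁∈) C∈′

mutual
  sub-0⁻ : ∀ {s} x {C : Exp s} {B} → PromotionFree C → B ∈ sub x [] C → B ≡ C × ¬ Free x C
  sub-0⁻ x {var y} pvar B∈ with sub-var⁻ {x} {[]} {y} B∈
  ... | inj₂ (y≢x , refl) = refl , λ { fvar → y≢x refl }
  sub-0⁻ x {lam M} (plam p) B∈ with ∈-map⁻ lam B∈
  ... | _ , B₀∈ , refl with sub-0⁻ (suc x) p B₀∈
  ...   | refl , ¬f = refl , λ { (flam f) → ¬f f }
  sub-0⁻ x {app M P} (papp p q) B∈ with sub-app⁻ {x} {[]} {M} {P} B∈
  ... | _ , _ , refl , M₀∈ , P₀∈ with sub-0⁻ x p M₀∈ | sub-0⁻ x q P₀∈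
  ...   | refl , ¬f | refl , ¬g = refl , λ { (fappl f) → ¬f f ; (fappr f) → ¬g f }
  sub-0⁻ x {tbar V} (ptbar p) B∈ with ∈-map⁻ tbar B∈
  ... | _ , B₀∈ , refl with sub-0⁻ x p B₀∈
  ...   | refl , ¬f = refl , λ { (ftbar f) → ¬f f }
  sub-0⁻ x {tau Ls} (ptau p) B∈ with ∈-map⁻ tau B∈
  ... | _ , Bs∈ , refl with subL-0⁻ x p Bs∈
  ...   | refl , ¬f = refl , λ { (ftau f) → ¬f f }
  sub-0⁻ x {bag Ls []} (pbag p) B∈ with ∈-map⁻ (λ Ls' → bag₀ Ls') B∈
  ... | _ , Bs∈ , refl with subL-0⁻ x p Bs∈
  ...   | refl , ¬f = refl , λ { (fbagl f) → ¬f f ; (fbagp ()) }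

  subL-0⁻ : ∀ x {Ls Bs} → PromotionFreeL Ls → Bs ∈ subL x [] Ls → Bs ≡ Ls × ¬ FreeL x Ls
  subL-0⁻ x {[]}     []       (here refl) = refl , λ ()
  subL-0⁻ x {L ∷ Ls} (p ∷ ps) Bs∈ with subL-∷⁻ {x} {[]} {L} {Ls} Bs∈
  ... | _ , _ , refl , B∈ , Bs′∈ with sub-0⁻ x p B∈ | subL-0⁻ x ps Bs′∈
  ...   | refl , ¬f | refl , ¬g = refl , λ { (here f) → ¬f f ; (there f) → ¬g f }

mutual
  sub-0⁺ : ∀ {s} x {C : Exp s} → PromotionFree C → ¬ Free x C → C ∈ sub x [] C
  sub-0⁺ x           pvar       ¬f = sub-var-other⁺ λ { refl → ¬f fvar }
  sub-0⁺ x           (plam p)   ¬f = ∈-map⁺ lam (sub-0⁺ (suc x) p (¬f ∘ flam))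
  sub-0⁺ x {app M P} (papp p q) ¬f =
    sub-app⁺ {x} {[]} {M} {P} (sub-0⁺ x p (¬f ∘ fappl)) (sub-0⁺ x q (¬f ∘ fappr))
  sub-0⁺ x           (ptbar p)  ¬f = ∈-map⁺ tbar (sub-0⁺ x p (¬f ∘ ftbar))
  sub-0⁺ x           (ptau p)   ¬f = ∈-map⁺ tau (subL-0⁺ x p (¬f ∘ ftau))
  sub-0⁺ x           (pbag p)   ¬f = ∈-map⁺ bag₀ (subL-0⁺ x p (¬f ∘ fbagl))

  subL-0⁺ : ∀ x {Ls} → PromotionFreeL Ls → ¬ FreeL x Ls → Ls ∈ subL x [] Ls
  subL-0⁺ x          []       ¬f = here refl
  subL-0⁺ x {L ∷ Ls} (p ∷ ps) ¬f = subL-∷⁺ {x} {[]} {L} {Ls} (sub-0⁺ x p (¬f ∘ here)) (subL-0⁺ x ps (¬f ∘ there))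

-- Cs ∈ Ls⟨P/x⟩ componentwise: each item of P is substituted into exactly one Lᵢ,
-- the items sent to the same Lᵢ in the order they have in P.
data LsubManyL (x : ℕ) : List (Exp tm) → List (Exp tm) → List (Exp tm) → Set where
  []   : LsubManyL x [] [] []
  cons : ∀ {P₁ P₂ P L Ls C Cs} → Interleaving P₁ P₂ P → C ∈ lsubMany x P₁ L → LsubManyL x P₂ Ls Cs
       → LsubManyL x P (L ∷ Ls) (C ∷ Cs)

lsubManyL-[]⁺ : ∀ {x} Ls → LsubManyL x [] Ls Ls
lsubManyL-[]⁺ []       = []
lsubManyL-[]⁺ (L ∷ Ls) = cons [] (here refl) (lsubManyL-[]⁺ Ls)

lsubManyL-[]⁻ : ∀ {x Ls Cs} → LsubManyL x [] Ls Cs → Cs ≡ Ls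
lsubManyL-[]⁻ []                       = refl
lsubManyL-[]⁻ (cons [] (here refl) m) = cong (_ ∷_) (lsubManyL-[]⁻ m)

lsubManyL-++⁺ : ∀ {x P₁ P₂ Xs Ys Cs Ds} → LsubManyL x P₁ Xs Cs → LsubManyL x P₂ Ys Ds
  → LsubManyL x (P₁ ++ P₂) (Xs ++ Ys) (Cs ++ Ds)
lsubManyL-++⁺             []           m' = m'
lsubManyL-++⁺ {P₂ = P₂} (cons i C∈ m) m' = cons (interleaving-++ʳ i P₂) C∈ (lsubManyL-++⁺ m m')

lsubManyL-++⁻ : ∀ {x P Ys Cs} Xs → LsubManyL x P (Xs ++ Ys) Cs
  → ∃[ P₁ ] ∃[ P₂ ] ∃[ Cs₁ ] ∃[ Cs₂ ]
      (Interleaving P₁ P₂ P × Cs ≡ Cs₁ ++ Cs₂ × LsubManyL x P₁ Xs Cs₁ × LsubManyL x P₂ Ys Cs₂)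
lsubManyL-++⁻ {P = P} [] m = [] , P , [] , _ , interleaving-[]ˡ P , refl , [] , m
lsubManyL-++⁻ (X ∷ Xs) (cons i C∈ m) with lsubManyL-++⁻ Xs m
... | P₁ , P₂ , Cs₁ , Cs₂ , j , refl , m₁ , m₂ with interleaving-reassoc i j
...   | P₁′ , i₁ , i₂ = P₁′ , P₂ , _ ∷ Cs₁ , Cs₂ , i₂ , refl , cons i₁ C∈ m₁ , m₂

module _ {x : ℕ} where

  lsubMany-lam⁺ : ∀ P {M C} → C ∈ lsubMany (suc x) (map (shift 0) P) M → lam C ∈ lsubMany x P (lam M)
  lsubMany-lam⁺ []      (here refl) = here refl
  lsubMany-lam⁺ (L ∷ P) {M} C∈ with ∈-concatMap⁻′ (lsubMany (suc x) (map (shift 0) P)) (lsub (suc x) (shift 0 L) M) C∈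
  ... | M₁ , M₁∈ , C∈′ = ∈-concatMap⁺′ (lsubMany x P) (∈-map⁺ lam M₁∈) (lsubMany-lam⁺ P C∈′)

  lsubMany-lam⁻ : ∀ P {M C} → C ∈ lsubMany x P (lam M)
    → ∃[ C₀ ] (C ≡ lam C₀ × C₀ ∈ lsubMany (suc x) (map (shift 0) P) M)
  lsubMany-lam⁻ []      (here refl) = _ , refl , here refl
  lsubMany-lam⁻ (L ∷ P) {M} C∈ with ∈-concatMap⁻′ (lsubMany x P) (map lam (lsub (suc x) (shift 0 L) M)) C∈
  ... | _ , M₁∈ , C∈′ with ∈-map⁻ lam M₁∈
  ...   | M₁ , M₁∈′ , refl with lsubMany-lam⁻ P C∈′
  ...     | C₀ , refl , C₀∈ = C₀ , refl , ∈-concatMap⁺′ (lsubMany (suc x) (map (shift 0) P)) M₁∈′ C₀∈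

  lsubMany-tbar⁺ : ∀ P {V C} → C ∈ lsubMany x P V → tbar C ∈ lsubMany x P (tbar V)
  lsubMany-tbar⁺ []      (here refl) = here refl
  lsubMany-tbar⁺ (L ∷ P) {V} C∈ with ∈-concatMap⁻′ (lsubMany x P) (lsub x L V) C∈
  ... | V₁ , V₁∈ , C∈′ = ∈-concatMap⁺′ (lsubMany x P) (∈-map⁺ tbar V₁∈) (lsubMany-tbar⁺ P C∈′)

  lsubMany-tbar⁻ : ∀ P {V C} → C ∈ lsubMany x P (tbar V) → ∃[ C₀ ] (C ≡ tbar C₀ × C₀ ∈ lsubMany x P V)
  lsubMany-tbar⁻ []      (here refl) = _ , refl , here refl
  lsubMany-tbar⁻ (L ∷ P) {V} C∈ with ∈-concatMap⁻′ (lsubMany x P) (map tbar (lsub x L V)) C∈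
  ... | _ , V₁∈ , C∈′ with ∈-map⁻ tbar V₁∈
  ...   | V₁ , V₁∈′ , refl with lsubMany-tbar⁻ P C∈′
  ...     | C₀ , refl , C₀∈ = C₀ , refl , ∈-concatMap⁺′ (lsubMany x P) V₁∈′ C₀∈

  lsubMany-app⁺ : ∀ {P₁ P₂ P M Q C₁ C₂} → Interleaving P₁ P₂ P
    → C₁ ∈ lsubMany x P₁ M → C₂ ∈ lsubMany x P₂ Q → app C₁ C₂ ∈ lsubMany x P (app M Q)
  lsubMany-app⁺ [] (here refl) (here refl) = here refl
  lsubMany-app⁺ {L ∷ P₁} {_} {L ∷ P} {M} {Q} (consˡ i) C₁∈ C₂∈
    with ∈-concatMap⁻′ (lsubMany x P₁) (lsub x L M) C₁∈
  ... | M₁ , M₁∈ , C₁∈′ =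
    ∈-concatMap⁺′ (lsubMany x P) (lsub-appˡ⁺ {M = M} {P = Q} M₁∈) (lsubMany-app⁺ i C₁∈′ C₂∈)
  lsubMany-app⁺ {_} {L ∷ P₂} {L ∷ P} {M} {Q} (consʳ i) C₁∈ C₂∈
    with ∈-concatMap⁻′ (lsubMany x P₂) (lsub x L Q) C₂∈
  ... | Q₁ , Q₁∈ , C₂∈′ =
    ∈-concatMap⁺′ (lsubMany x P) (lsub-appʳ⁺ {M = M} {P = Q} Q₁∈) (lsubMany-app⁺ i C₁∈ C₂∈′)

  lsubMany-app⁻ : ∀ P {M Q C} → C ∈ lsubMany x P (app M Q)
    → ∃[ C₁ ] ∃[ C₂ ] ∃[ P₁ ] ∃[ P₂ ]
        (C ≡ app C₁ C₂ × Interleaving P₁ P₂ P × C₁ ∈ lsubMany x P₁ M × C₂ ∈ lsubMany x P₂ Q)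
  lsubMany-app⁻ []      (here refl) = _ , _ , [] , [] , refl , [] , here refl , here refl
  lsubMany-app⁻ (L ∷ P) {M} {Q} C∈ with ∈-concatMap⁻′ (lsubMany x P) (lsub x L (app M Q)) C∈
  ... | _ , A₁∈ , C∈′ with lsub-app⁻ {M = M} {Q} A₁∈
  ...   | inj₁ (M₁ , M₁∈ , refl) with lsubMany-app⁻ P C∈′
  ...     | C₁ , C₂ , P₁ , P₂ , refl , i , C₁∈ , C₂∈ =
    C₁ , C₂ , L ∷ P₁ , P₂ , refl , consˡ i , ∈-concatMap⁺′ (lsubMany x P₁) M₁∈ C₁∈ , C₂∈
  lsubMany-app⁻ (L ∷ P) {M} {Q} C∈ | _ , A₁∈ , C∈′ | inj₂ (Q₁ , Q₁∈ , refl) with lsubMany-app⁻ P C∈′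
  ...     | C₁ , C₂ , P₁ , P₂ , refl , i , C₁∈ , C₂∈ =
    C₁ , C₂ , P₁ , L ∷ P₂ , refl , consʳ i , C₁∈ , ∈-concatMap⁺′ (lsubMany x P₂) Q₁∈ C₂∈

module ListConstructor {s} (f : List (Exp tm) → Exp s)
  (lsub-f⁻ : ∀ {x L Ls C} → C ∈ lsub x L (f Ls) → ∃[ Ls₁ ] (Ls₁ ∈ lsubL x L Ls × C ≡ f Ls₁))
  (lsub-f⁺ : ∀ {x L Ls Ls₁} → Ls₁ ∈ lsubL x L Ls → f Ls₁ ∈ lsub x L (f Ls)) where

  private
    step⁻ : ∀ {x L P} Ls {Ls₁ Cs} → Ls₁ ∈ lsubL x L Ls → LsubManyL x P Ls₁ Cs → LsubManyL x (L ∷ P) Ls Cs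
    step⁻ {x} {L} (L₀ ∷ Ls) Ls₁∈ m with lsubL-∷⁻ {L = L₀} {Ls} Ls₁∈
    step⁻ {x} {L} (L₀ ∷ Ls) _ (cons {P₁ = P₁} i C∈ m) | inj₁ (L₁ , L₁∈ , refl) =
      cons (consˡ i) (∈-concatMap⁺′ (lsubMany x P₁) L₁∈ C∈) m
    step⁻ (L₀ ∷ Ls) _ (cons i C∈ m) | inj₂ (Ls₁ , Ls₁∈ , refl) = cons (consʳ i) C∈ (step⁻ Ls Ls₁∈ m)

    step⁺ : ∀ {x L P} Ls {Cs} → LsubManyL x (L ∷ P) Ls Cs → ∃[ Ls₁ ] (Ls₁ ∈ lsubL x L Ls × LsubManyL x P Ls₁ Cs)
    step⁺ {x} {L} (L₀ ∷ Ls) (cons {P₁ = L ∷ P₁} (consˡ i) C∈ m)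
      with ∈-concatMap⁻′ (lsubMany x P₁) (lsub x L L₀) C∈
    ... | L₁ , L₁∈ , C∈′ = L₁ ∷ Ls , lsubL-here⁺ L₁∈ , cons i C∈′ m
    step⁺ (L₀ ∷ Ls) (cons (consʳ i) C∈ m) with step⁺ Ls m
    ... | Ls₁ , Ls₁∈ , m′ = L₀ ∷ Ls₁ , lsubL-there⁺ Ls₁∈ , cons i C∈ m′

  lsubMany⁻ : ∀ {x} P {Ls C} → C ∈ lsubMany x P (f Ls) → ∃[ Cs ] (C ≡ f Cs × LsubManyL x P Ls Cs)
  lsubMany⁻ []          {Ls} (here refl) = Ls , refl , lsubManyL-[]⁺ Ls
  lsubMany⁻ {x} (L ∷ P) {Ls} C∈ with ∈-concatMap⁻′ (lsubMany x P) (lsub x L (f Ls)) C∈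
  ... | _ , A₁∈ , C∈′ with lsub-f⁻ A₁∈
  ...   | Ls₁ , Ls₁∈ , refl with lsubMany⁻ P C∈′
  ...     | Cs , refl , m = Cs , refl , step⁻ Ls Ls₁∈ m

  lsubMany⁺ : ∀ {x} P {Ls Cs} → LsubManyL x P Ls Cs → f Cs ∈ lsubMany x P (f Ls)
  lsubMany⁺ []      m with lsubManyL-[]⁻ m
  ... | refl = here refl
  lsubMany⁺ {x} (L ∷ P) {Ls} m with step⁺ Ls m
  ... | Ls₁ , Ls₁∈ , m′ = ∈-concatMap⁺′ (lsubMany x P) (lsub-f⁺ Ls₁∈) (lsubMany⁺ P m′)

module Tau = ListConstructor tau (∈-map⁻ tau) (∈-map⁺ tau)

lsub-bag₀⁻ : ∀ {x L Ls C} → C ∈ lsub x L (bag₀ Ls) → ∃[ Ls₁ ] (Ls₁ ∈ lsubL x L Ls × C ≡ bag₀ Ls₁)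
lsub-bag₀⁻ {x} {L} {Ls} C∈ with lsub-bag⁻ {x} {L} {Ls} {[]} C∈
... | inj₁ r = r
... | inj₂ (_ , () , _)

module Bag = ListConstructor bag₀ (λ {x} {L} {Ls} → lsub-bag₀⁻ {x} {L} {Ls})
  (λ {x} {L} {Ls} {Ls₁} → lsub-bagˡ⁺ {x} {L} {Ls} {Ls₁} {[]})

-- Taylor expansion of a substitution

mutual
  𝒯-sub-⊆ : ∀ {s} (A : Exp s) x 𝕄 {A₀ B} → A₀ ∈ sub x 𝕄 A → Tay A₀ B
    → ∃[ P ] ∃[ A' ] (TaySums 𝕄 P × Tay A A' × B ∈ lsubMany x P A')
  𝒯-sub-⊆ (var y) x 𝕄 A₀∈ t with sub-var⁻ {x} {𝕄} {y} A₀∈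
  ... | inj₁ (refl , A₀∈𝕄) = _ ∷ [] , var y , taySum⁺ A₀∈𝕄 t ∷ [] , tvar ,
                             ∈-concatMap⁺′ (lsubMany y []) (lsub-var-self y _) (here refl)
  𝒯-sub-⊆ (var y) x 𝕄 _ tvar | inj₂ (_ , refl) = [] , var y , [] , tvar , here refl
  𝒯-sub-⊆ (lam M) x 𝕄 A₀∈ t with ∈-map⁻ lam A₀∈
  𝒯-sub-⊆ (lam M) x 𝕄 _ (tlam t) | M₀ , M₀∈ , refl with 𝒯-sub-⊆ M (suc x) (map (shift 0) 𝕄) M₀∈ t
  ... | P↑ , M' , tP↑ , tM , B∈ with taySums-map-shift⁻ 𝕄 tP↑
  ...   | P , refl , tP = P , lam M' , tP , tlam tM , lsubMany-lam⁺ P B∈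
  𝒯-sub-⊆ (app M Q) x 𝕄 A₀∈ t with sub-app⁻ {x} {𝕄} {M} {Q} A₀∈
  𝒯-sub-⊆ (app M Q) x 𝕄 _ (tapp t u) | M₀ , Q₀ , refl , M₀∈ , Q₀∈
    with 𝒯-sub-⊆ M x 𝕄 M₀∈ t | 𝒯-sub-⊆ Q x 𝕄 Q₀∈ u
  ... | P₁ , M' , tP₁ , tM , B₁∈ | P₂ , Q' , tP₂ , tQ , B₂∈ =
    P₁ ++ P₂ , app M' Q' , taySums-++⁺ tP₁ tP₂ , tapp tM tQ , lsubMany-app⁺ (interleaving-++ P₁ P₂) B₁∈ B₂∈
  𝒯-sub-⊆ (tbar V) x 𝕄 A₀∈ t with ∈-map⁻ tbar A₀∈
  𝒯-sub-⊆ (tbar V) x 𝕄 _ (ttbar t) | V₀ , V₀∈ , refl with 𝒯-sub-⊆ V x 𝕄 V₀∈ t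
  ... | P , V' , tP , tV , B∈ = P , tbar V' , tP , ttbar tV , lsubMany-tbar⁺ P B∈
  𝒯-sub-⊆ (tau Ls) x 𝕄 A₀∈ t with ∈-map⁻ tau A₀∈
  𝒯-sub-⊆ (tau Ls) x 𝕄 _ (ttau t) | Ls₀ , Ls₀∈ , refl with 𝒯-subL-⊆ Ls x 𝕄 Ls₀∈ t
  ... | P , Ls' , tP , tLs , m = P , tau Ls' , tP , ttau tLs , Tau.lsubMany⁺ P m
  𝒯-sub-⊆ (bag Ls S) x 𝕄 A₀∈ t with ∈-map⁻ (λ Ls' → bag Ls' (subS x 𝕄 S)) A₀∈
  𝒯-sub-⊆ (bag Ls S) x 𝕄 _ (tbag t u) | Ls₀ , Ls₀∈ , refl
    with 𝒯-subL-⊆ Ls x 𝕄 Ls₀∈ t | 𝒯Sums-subS-⊆ S x 𝕄 u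
  ... | P₁ , Ls' , tP₁ , tLs , m₁ | P₂ , Ps₀ , tP₂ , tPs₀ , m₂ =
    P₁ ++ P₂ , bag₀ (Ls' ++ Ps₀) , taySums-++⁺ tP₁ tP₂ , tbag tLs tPs₀ ,
    Bag.lsubMany⁺ (P₁ ++ P₂) (lsubManyL-++⁺ m₁ m₂)

  𝒯-subL-⊆ : ∀ Ls x 𝕄 {Ls₀ Bs} → Ls₀ ∈ subL x 𝕄 Ls → TayL Ls₀ Bs
    → ∃[ P ] ∃[ Ls' ] (TaySums 𝕄 P × TayL Ls Ls' × LsubManyL x P Ls' Bs)
  𝒯-subL-⊆ []       x 𝕄 (here refl) [] = [] , [] , [] , [] , []
  𝒯-subL-⊆ (L ∷ Ls) x 𝕄 Ls₀∈ t with subL-∷⁻ {x} {𝕄} {L} {Ls} Ls₀∈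
  𝒯-subL-⊆ (L ∷ Ls) x 𝕄 _ (t ∷ ts′) | L₀ , Ls₁ , refl , L₀∈ , Ls₁∈
    with 𝒯-sub-⊆ L x 𝕄 L₀∈ t | 𝒯-subL-⊆ Ls x 𝕄 Ls₁∈ ts′
  ... | P₁ , L' , tP₁ , tL , B∈ | P₂ , Ls' , tP₂ , tLs , m =
    P₁ ++ P₂ , L' ∷ Ls' , taySums-++⁺ tP₁ tP₂ , tL ∷ tLs , cons (interleaving-++ P₁ P₂) B∈ m

  𝒯Sums-subS-⊆ : ∀ S x 𝕄 {Ps} → TaySums (subS x 𝕄 S) Ps
    → ∃[ P ] ∃[ Ps₀ ] (TaySums 𝕄 P × TaySums S Ps₀ × LsubManyL x P Ps₀ Ps)
  𝒯Sums-subS-⊆ S x 𝕄 []        = [] , [] , [] , [] , []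
  𝒯Sums-subS-⊆ S x 𝕄 (q ∷ qs) with taySum⁻ q
  ... | M₀ , M₀∈ , t with 𝒯-subS-⊆ S x 𝕄 M₀∈ t | 𝒯Sums-subS-⊆ S x 𝕄 qs
  ...   | P₁ , Q₀ , tP₁ , tQ₀ , B∈ | P₂ , Ps₀ , tP₂ , tPs₀ , m =
    P₁ ++ P₂ , Q₀ ∷ Ps₀ , taySums-++⁺ tP₁ tP₂ , tQ₀ ∷ tPs₀ , cons (interleaving-++ P₁ P₂) B∈ m

  𝒯-subS-⊆ : ∀ S x 𝕄 {M₀ Q} → M₀ ∈ subS x 𝕄 S → Tay M₀ Q
    → ∃[ P ] ∃[ Q₀ ] (TaySums 𝕄 P × TaySum S Q₀ × Q ∈ lsubMany x P Q₀)
  𝒯-subS-⊆ (M ∷ S) x 𝕄 M₀∈ t with ∈-++⁻ (sub x 𝕄 M) M₀∈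
  ... | inj₁ M₀∈ˡ with 𝒯-sub-⊆ M x 𝕄 M₀∈ˡ t
  ...   | P , Q₀ , tP , tQ₀ , B∈ = P , Q₀ , tP , here tQ₀ , B∈
  𝒯-subS-⊆ (M ∷ S) x 𝕄 M₀∈ t | inj₂ M₀∈ʳ with 𝒯-subS-⊆ S x 𝕄 M₀∈ʳ t
  ...   | P , Q₀ , tP , tQ₀ , B∈ = P , Q₀ , tP , there tQ₀ , B∈

mutual
  𝒯-sub-⊇ : ∀ {s} (A : Exp s) x 𝕄 {P A' C} → All (λ M → ¬ Free x M) 𝕄 → TaySums 𝕄 P → Tay A A'
    → C ∈ lsubMany x P A' → ¬ Free x C → ∃[ A₀ ] (A₀ ∈ sub x 𝕄 A × Tay A₀ C)
  𝒯-sub-⊇ (var y) x 𝕄 {[]} h [] tvar (here refl) ¬f = var y , sub-var-other⁺ (λ { refl → ¬f fvar }) , tvar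
  𝒯-sub-⊇ (var y) x 𝕄 {L ∷ P} h (tL ∷ tP) tvar C∈ ¬f with ∈-concatMap⁻′ (lsubMany x P) (lsub x L (var y)) C∈
  ... | _ , A₁∈ , C∈′ with lsub-var⁻ {x} {y} A₁∈
  𝒯-sub-⊇ (var y) x 𝕄 {L ∷ []} h (tL ∷ tP) tvar _ ¬f | _ , _ , here refl | refl , refl with taySum⁻ tL
  ... | M , M∈ , t = M , sub-var-self⁺ M∈ , t
  𝒯-sub-⊇ (var y) x 𝕄 {L ∷ L₂ ∷ P} h (tL ∷ tP) tvar _ ¬f | _ , _ , C∈′ | refl , refl
    with ∈-concatMap⁻′ (lsubMany y P) (lsub y L₂ L) C∈′
  ... | _ , A₂∈ , _ with freeL⁻ (taySum-FreeL⁻ tL (lsub-Free L A₂∈))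
  ...   | M , M∈ , f = ⊥-elim (All.lookup h M∈ f)
  𝒯-sub-⊇ (lam M) x 𝕄 {P} h tP (tlam tM) C∈ ¬f with lsubMany-lam⁻ P C∈
  ... | C₀ , refl , C₀∈
    with 𝒯-sub-⊇ M (suc x) (map (shift 0) 𝕄) (¬Free-map-shift h) (taySums-map-shift⁺ tP) tM C₀∈ (¬f ∘ flam)
  ...   | M₀ , M₀∈ , t = lam M₀ , ∈-map⁺ lam M₀∈ , tlam t
  𝒯-sub-⊇ (app M Q) x 𝕄 {P} h tP (tapp tM tQ) C∈ ¬f with lsubMany-app⁻ P C∈
  ... | C₁ , C₂ , P₁ , P₂ , refl , i , C₁∈ , C₂∈ with taySums-interleaving⁻ tP i
  ...   | tP₁ , tP₂
    with 𝒯-sub-⊇ M x 𝕄 h tP₁ tM C₁∈ (¬f ∘ fappl) | 𝒯-sub-⊇ Q x 𝕄 h tP₂ tQ C₂∈ (¬f ∘ fappr)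
  ...     | M₀ , M₀∈ , t | Q₀ , Q₀∈ , u = app M₀ Q₀ , sub-app⁺ {x} {𝕄} {M} {Q} M₀∈ Q₀∈ , tapp t u
  𝒯-sub-⊇ (tbar V) x 𝕄 {P} h tP (ttbar tV) C∈ ¬f with lsubMany-tbar⁻ P C∈
  ... | C₀ , refl , C₀∈ with 𝒯-sub-⊇ V x 𝕄 h tP tV C₀∈ (¬f ∘ ftbar)
  ...   | V₀ , V₀∈ , t = tbar V₀ , ∈-map⁺ tbar V₀∈ , ttbar t
  𝒯-sub-⊇ (tau Ls) x 𝕄 {P} h tP (ttau tLs) C∈ ¬f with Tau.lsubMany⁻ P C∈
  ... | Cs , refl , m with 𝒯-subL-⊇ Ls x 𝕄 h tP tLs m (¬f ∘ ftau)
  ...   | Ls₀ , Ls₀∈ , t = tau Ls₀ , ∈-map⁺ tau Ls₀∈ , ttau t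
  𝒯-sub-⊇ (bag Ls S) x 𝕄 {P} h tP (tbag {Ls' = Ls'} tLs tPs) C∈ ¬f with Bag.lsubMany⁻ P C∈
  ... | Cs , refl , m with lsubManyL-++⁻ Ls' m
  ...   | P₁ , P₂ , Cs₁ , Cs₂ , i , refl , m₁ , m₂ with taySums-interleaving⁻ tP i
  ...     | tP₁ , tP₂ with 𝒯-subL-⊇ Ls x 𝕄 h tP₁ tLs m₁ (¬f ∘ fbagl ∘ freeL-++⁺ˡ)
  ...       | Ls₀ , Ls₀∈ , t =
    bag Ls₀ (subS x 𝕄 S) , ∈-map⁺ (λ Ls₁ → bag Ls₁ (subS x 𝕄 S)) Ls₀∈ ,
    tbag t (𝒯Sums-subS-⊇ S x 𝕄 h tP₂ tPs m₂ (¬f ∘ fbagl ∘ freeL-++⁺ʳ Cs₁))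

  𝒯-subL-⊇ : ∀ Ls x 𝕄 {P Ls' Cs} → All (λ M → ¬ Free x M) 𝕄 → TaySums 𝕄 P → TayL Ls Ls'
    → LsubManyL x P Ls' Cs → ¬ FreeL x Cs → ∃[ Ls₀ ] (Ls₀ ∈ subL x 𝕄 Ls × TayL Ls₀ Cs)
  𝒯-subL-⊇ []       x 𝕄 h tP []        []             ¬f = [] , here refl , []
  𝒯-subL-⊇ (L ∷ Ls) x 𝕄 h tP (tL ∷ tLs) (cons i C∈ m) ¬f with taySums-interleaving⁻ tP i
  ... | tP₁ , tP₂ with 𝒯-sub-⊇ L x 𝕄 h tP₁ tL C∈ (¬f ∘ here) | 𝒯-subL-⊇ Ls x 𝕄 h tP₂ tLs m (¬f ∘ there)
  ...   | L₀ , L₀∈ , t | Ls₀ , Ls₀∈ , ts′ = L₀ ∷ Ls₀ , subL-∷⁺ {x} {𝕄} {L} {Ls} L₀∈ Ls₀∈ , t ∷ ts′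

  𝒯Sums-subS-⊇ : ∀ S x 𝕄 {P Ps Cs} → All (λ M → ¬ Free x M) 𝕄 → TaySums 𝕄 P → TaySums S Ps
    → LsubManyL x P Ps Cs → ¬ FreeL x Cs → TaySums (subS x 𝕄 S) Cs
  𝒯Sums-subS-⊇ S x 𝕄 h tP []          []             ¬f = []
  𝒯Sums-subS-⊇ S x 𝕄 h tP (tQ ∷ tPs) (cons i C∈ m) ¬f with taySums-interleaving⁻ tP i
  ... | tP₁ , tP₂ with 𝒯-subS-⊇ S x 𝕄 h tP₁ tQ C∈ (¬f ∘ here)
  ...   | M₀ , M₀∈ , t = taySum⁺ M₀∈ t ∷ 𝒯Sums-subS-⊇ S x 𝕄 h tP₂ tPs m (¬f ∘ there)

  𝒯-subS-⊇ : ∀ S x 𝕄 {P Q₀ C} → All (λ M → ¬ Free x M) 𝕄 → TaySums 𝕄 P → TaySum S Q₀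
    → C ∈ lsubMany x P Q₀ → ¬ Free x C → ∃[ M₀ ] (M₀ ∈ subS x 𝕄 S × Tay M₀ C)
  𝒯-subS-⊇ (M ∷ S) x 𝕄 h tP (here tM) C∈ ¬f with 𝒯-sub-⊇ M x 𝕄 h tP tM C∈ ¬f
  ... | M₀ , M₀∈ , t = M₀ , ∈-++⁺ˡ M₀∈ , t
  𝒯-subS-⊇ (M ∷ S) x 𝕄 h tP (there tS) C∈ ¬f with 𝒯-subS-⊇ S x 𝕄 h tP tS C∈ ¬f
  ... | M₀ , M₀∈ , t = M₀ , ∈-++⁺ʳ (sub x 𝕄 M) M₀∈ , t

𝒯-lsub : ∀ {s} (A : Exp s) N x → 𝒯Σ (lsub x N A) ≐ (𝒯 A ⟨ 𝒯 N / x ⟩ₛ)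
𝒯-lsub A N x = ⊆ , ⊇
  where
  ⊆ : ∀ B → 𝒯Σ (lsub x N A) B → ∃[ C ] ((𝒯 A ⟨ 𝒯 N / x ⟩ₛ) C × B ≈ C)
  ⊆ B p with taySum⁻ p
  ... | A₀ , A₀∈ , t = 𝒯-lsub-⊆ A x N A₀∈ t

  ⊇ : ∀ C → (𝒯 A ⟨ 𝒯 N / x ⟩ₛ) C → ∃[ B ] (𝒯Σ (lsub x N A) B × B ≈ C)
  ⊇ C (A' , N' , tA , tN , C∈) with 𝒯-lsub-⊇ A x N tA tN C∈
  ... | A₀ , B , A₀∈ , t , e = B , taySum⁺ A₀∈ t , e

𝒯-sub : ∀ {s} (A : Exp s) 𝕄 x → All (λ M → ¬ Free x M) 𝕄 → 𝒯Σ (sub x 𝕄 A) ≐ ⋃Taylor (𝒯 A) 𝕄 x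
𝒯-sub A 𝕄 x x∉𝕄 = ⊆ , ⊇
  where
  ⊆ : ∀ B → 𝒯Σ (sub x 𝕄 A) B → ∃[ C ] (⋃Taylor (𝒯 A) 𝕄 x C × B ≈ C)
  ⊆ B p with taySum⁻ p
  ... | A₀ , A₀∈ , t with 𝒯-sub-⊆ A x 𝕄 A₀∈ t
  ...   | P , A' , tP , tA , B∈ =
    B , (P , tP , A' , B , tA , B∈ , sub-0⁺ x (𝒯-PromotionFree t) (sub-¬Free A x 𝕄 x∉𝕄 A₀∈ ∘ tay-Free⁻ t)) ,
    ≈-refl B

  ⊇ : ∀ C → ⋃Taylor (𝒯 A) 𝕄 x C → ∃[ B ] (𝒯Σ (sub x 𝕄 A) B × B ≈ C)
  ⊇ C (P , tP , A' , C' , tA , C'∈ , C∈)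
    with sub-0⁻ x (lsubMany-PromotionFree (𝒯Sums-PromotionFreeL tP) (𝒯-PromotionFree tA) C'∈) C∈
  ... | refl , ¬f with 𝒯-sub-⊇ A x 𝕄 x∉𝕄 tP tA C'∈ ¬f
  ...   | A₀ , A₀∈ , t = C , taySum⁺ A₀∈ t , ≈-refl C

-- Part (i) holds without the hypothesis that x is not free in N.
lemma8p5 : {s : Sort} (A : Exp s) (N : Exp tm) (𝕄 : Sum tm) (x : ℕ)
    → ¬ Free x N → All (λ M → ¬ Free x M) 𝕄
    → (𝒯Σ (lsub x N A) ≐ (𝒯 A ⟨ 𝒯 N / x ⟩ₛ))
      × (𝒯Σ (sub x 𝕄 A) ≐ ⋃Taylor (𝒯 A) 𝕄 x)
lemma8p5 A N 𝕄 x _ x∉𝕄 = 𝒯-lsub A N x , 𝒯-sub A 𝕄 x x∉𝕄
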